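{- Let $m\ge 3$ and $s$ be odd positive integers and $n=sm$. Let $$\sigma_1=(1,1,\dots,1,tc^{ -1})r,\qquad \sigma_2=(t,\beta_2,\dots,\beta_n)z\ \text{ with } \beta_i=c^{(-1)^{i-1}(2i-3)}\ (2\le i\le n),\qquad G=\langle\sigma_1,\sigma_2\rangle.$$ Then $\Gamma=C_n[mK_1]$ is the skeleton of a polytopal non-orientable reflexible map $\mathcal{M}$ of type $\{2n,2m\}$ with $\mathrm{Aut}(\mathcal{M})=\mathrm{Aut}^+(\mathcal{M})=G$.
   Context: $C_n[mK_1]$ has vertex set $\{1,\dots,n\}\times\{1,\dots,m\}$ with $(i_1,j_1)\sim(i_2,j_2)$ iff $i_1\equiv i_2\pm1\pmod n$ (residues mod $n$ represented by $1,\dots,n$, mod $m$ by $1,\dots,m$). For $\alpha_i\in S_m$ and a permutation $x$ of $\{1,\dots,n\}$, $(\alpha_1,\dots,\alpha_n)x$ is the vertex permutation $(i,j)\mapsto(ix,j\alpha_i)$; permutations act on the right, products composed left to right. $c=(1\,2\,\cdots\,m)$, $t\in S_m$ fixes $1$ and swaps $j\leftrightarrow m-j+2$ ($2\le j\le m$), $r=(1\,2\,\cdots\,n)$, $z$ fixes $1$ and swaps $j\leftrightarrow n-j+2$ ($2\le j\le n$). A map is a connected finite graph (skeleton) embedded in a closed surface with open-disk faces; polytopal: each face boundary is a cycle and each edge lies on two distinct faces. Map automorphisms are skeleton automorphisms extending to homeomorphisms of the surface. Rotary: vertex stabilisers contain cyclic groups transitive on incident edges and face stabilisers contain cyclic groups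 transitive on the face's vertices; type $\{p,q\}$: faces have $p$ edges, skeleton is $q$-valent. Reflexible: a face stabiliser also contains a reflection of the face. $\mathrm{Aut}^+(\mathcal{M})$ is the rotational group generated by the distinguished generators $\sigma_1$ (one-step rotation of a base face) and $\sigma_2$ (one-step rotation about a base vertex of that face), chosen so that $\sigma_1\sigma_2$ is an involution reversing a base edge. -}

module Defs where

open import Data.Nat as ℕ using (ℕ; zero; suc; _≤_; _<_)
open import Data.Integer as ℤ using (ℤ; +_; -1ℤ)
open import Data.Integer.DivMod using (_%ℕ_; n%ℕd<d)
open import Data.Fin as Fin using (Fin; toℕ; fromℕ<)
open import Data.Product using (Σ; ∃; _×_; _,_)
open import Data.Sum using (_⊎_)
open import Data.Bool using (Bool; not; if_then_else_)
open import Relation.Binary.PropositionalEquality using (_≡_; _≢_)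
open import Relation.Binary.Construct.Closure.ReflexiveTransitive using (Star)
open import Relation.Nullary using (¬_)
open import Function using (_∘_; id)

Odd : ℕ → Set
Odd k = ∃ λ j → k ≡ suc (2 ℕ.* j)

iter : {A : Set} → (A → A) → ℕ → A → A
iter f zero    x = x
iter f (suc k) x = f (iter f k x)

-- integer value of an element of Fin k (residues are 0-indexed:
-- the paper's residue i ∈ {1..n} is represented by i-1 ∈ Fin n)
ι : ∀ {k} → Fin k → ℤ
ι i = + toℕ i

-- reduce an integer modulo k; the Fin argument only witnesses k > 0
reduce : ∀ {k} → Fin k → ℤ → Fin k
reduce {suc k} _ z = fromℕ< (n%ℕd<d z (suc k))

-- Subgroup generated by two permutations (of any set), as a predicate
-- on endofunctions; equality of functions is taken pointwise (ext).

data ⟨_,_⟩ {A : Set} (f g : A → A) : (A → A) → Set where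
  gen₁ : ⟨ f , g ⟩ f
  gen₂ : ⟨ f , g ⟩ g
  one  : ⟨ f , g ⟩ id
  mul  : ∀ {h k} → ⟨ f , g ⟩ h → ⟨ f , g ⟩ k → ⟨ f , g ⟩ (k ∘ h)
  inv  : ∀ {h k} → ⟨ f , g ⟩ h → (∀ x → k (h x) ≡ x) → (∀ x → h (k x) ≡ x)
       → ⟨ f , g ⟩ k
  ext  : ∀ {h k} → ⟨ f , g ⟩ h → (∀ x → h x ≡ k x) → ⟨ f , g ⟩ k

V : ℕ → ℕ → Set
V n m = Fin n × Fin m

Adj : (n m : ℕ) → V n m → V n m → Set
Adj n m (i₁ , j₁) (i₂ , j₂) =
  (i₁ ≡ reduce i₂ (ι i₂ ℤ.+ + 1)) ⊎ (i₁ ≡ reduce i₂ (ι i₂ ℤ.- + 1))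

-- c^e : j ↦ j + e (mod m)   (c = (1 2 ... m))
cpow : ∀ {m} → ℤ → Fin m → Fin m
cpow e j = reduce j (ι j ℤ.+ e)

-- t : j ↦ -j (mod m)  (fixes 1 and swaps j ↔ m-j+2 in 1-indexed terms)
t : ∀ {m} → Fin m → Fin m
t j = reduce j (ℤ.- ι j)

r : ∀ {n} → Fin n → Fin n
r i = reduce i (ι i ℤ.+ + 1)

z : ∀ {n} → Fin n → Fin n
z i = reduce i (ℤ.- ι i)

-- σ₁ = (1,...,1,t c⁻¹) r : (i,j) ↦ (i r, j α_i), α_n = t c⁻¹ (t first)
σ₁ : (n m : ℕ) → V n m → V n m
σ₁ n m (i , j) =
  (r i , (if suc (toℕ i) ℕ.≡ᵇ n then cpow -1ℤ (t j) else j))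

-- exponent of β_p (paper index p = 2..n):  (-1)^(p-1) (2p-3)
βexp : ℕ → ℤ
βexp p = (-1ℤ ℤ.^ (p ℕ.∸ 1)) ℤ.* (+ (2 ℕ.* p) ℤ.- + 3)

-- σ₂ = (t, β₂, ..., β_n) z,  β_p = c^βexp(p)
σ₂ : (n m : ℕ) → V n m → V n m
σ₂ n m (i , j) =
  (z i , (if toℕ i ℕ.≡ᵇ 0 then t j else cpow (βexp (suc (toℕ i))) j))

-- Combinatorial (flag) maps: flags Fin N with involutions r₀ r₁ r₂.
-- r₀ changes the vertex, r₁ the edge, r₂ the face of a flag.

record FlagMap : Set where
  field
    N : ℕ
    r₀ r₁ r₂ : Fin N → Fin N
    r₀-inv : ∀ a → r₀ (r₀ a) ≡ a
    r₁-inv : ∀ a → r₁ (r₁ a) ≡ a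
    r₂-inv : ∀ a → r₂ (r₂ a) ≡ a
    r₀-fpf : ∀ a → r₀ a ≢ a
    r₁-fpf : ∀ a → r₁ a ≢ a
    r₂-fpf : ∀ a → r₂ a ≢ a
    r₀r₂-comm : ∀ a → r₀ (r₂ a) ≡ r₂ (r₀ a)
    r₀r₂-fpf  : ∀ a → r₀ (r₂ a) ≢ a
    connected : ∀ a b →
      Star (λ x y → (y ≡ r₀ x) ⊎ (y ≡ r₁ x) ⊎ (y ≡ r₂ x)) a b

module _ (M : FlagMap) where
  open FlagMap M

  SameVertex SameEdge SameFace : Fin N → Fin N → Set
  SameVertex = Star (λ x y → (y ≡ r₁ x) ⊎ (y ≡ r₂ x))
  SameEdge   = Star (λ x y → (y ≡ r₀ x) ⊎ (y ≡ r₂ x))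
  SameFace   = Star (λ x y → (y ≡ r₀ x) ⊎ (y ≡ r₁ x))

  faceRot vertRot : Fin N → Fin N
  faceRot = r₁ ∘ r₀
  vertRot = r₂ ∘ r₁

  OrderAt : (Fin N → Fin N) → Fin N → ℕ → Set
  OrderAt f a k = 0 < k × iter f k a ≡ a × (∀ i → 0 < i → i < k → iter f i a ≢ a)

  IsAut : (Fin N → Fin N) → Set
  IsAut g = (Σ (Fin N → Fin N) λ h → (∀ a → h (g a) ≡ a) × (∀ a → g (h a) ≡ a))
          × (∀ a → g (r₀ a) ≡ r₀ (g a))
          × (∀ a → g (r₁ a) ≡ r₁ (g a))
          × (∀ a → g (r₂ a) ≡ r₂ (g a))

  HasType : ℕ → ℕ → Set
  HasType p q = ∀ a → OrderAt faceRot a p × OrderAt vertRot a q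

  NonOrientable : Set
  NonOrientable = ¬ (Σ (Fin N → Bool) λ col →
      ∀ a → col (r₀ a) ≡ not (col a) × col (r₁ a) ≡ not (col a)
                                      × col (r₂ a) ≡ not (col a))

  Rotary : Set
  Rotary =
    (∀ a → Σ (Fin N → Fin N) λ g → IsAut g × SameVertex a (g a)
         × (∀ b → SameVertex a b → ∃ λ k → SameEdge (iter g k a) b))
    × (∀ a → Σ (Fin N → Fin N) λ g → IsAut g × SameFace a (g a)
         × (∀ b → SameFace a b → ∃ λ k → SameVertex (iter g k a) b))

  -- reflexible: rotary, and some face stabiliser contains a reflection of
  -- the face (an automorphism sending a flag a of the face to a flag of the
  -- same face with the opposite orientation)
  Reflexible : Set
  Reflexible = Rotary × (Σ (Fin N → Fin N) λ g → IsAut g ×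
      ∃ λ a → ∃ λ k → g a ≡ iter faceRot k (r₀ a))

  -- distinguished generators at base flag a: σ₁ one-step rotation of the
  -- face of a, σ₂ one-step rotation about the vertex of a, with σ₁σ₂
  -- (σ₁ first) sending a to r₀ r₂ a, i.e. reversing the base edge
  Distinguished : Fin N → (Fin N → Fin N) → (Fin N → Fin N) → Set
  Distinguished a g₁ g₂ = IsAut g₁ × IsAut g₂
    × g₁ a ≡ r₀ (r₁ a) × g₂ a ≡ r₁ (r₂ a) × g₂ (g₁ a) ≡ r₀ (r₂ a)

  -- identification of the skeleton with the graph (W, Adj'):
  -- vertices of the map = ⟨r₁,r₂⟩-orbits, edges = ⟨r₀,r₂⟩-orbits joining
  -- the vertices of a and r₀ a
  record SkeletonIso (W : Set) (Adj' : W → W → Set) : Set where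
    field
      vert      : Fin N → W
      vert-surj : ∀ w → ∃ λ a → vert a ≡ w
      vert-same : ∀ a b → vert a ≡ vert b → SameVertex a b
      same-vert : ∀ a b → SameVertex a b → vert a ≡ vert b
      edge-adj  : ∀ a → Adj' (vert a) (vert (r₀ a))
      edge-surj : ∀ u w → Adj' u w → ∃ λ a → vert a ≡ u × vert (r₀ a) ≡ w
      edge-inj  : ∀ a b → vert a ≡ vert b → vert (r₀ a) ≡ vert (r₀ b)
                → SameEdge a b

  module _ {W : Set} {Adj' : W → W → Set} (φ : SkeletonIso W Adj') where
    open SkeletonIso φ

    Polytopal : Set
    Polytopal =
      (∀ a → ∃ λ k → OrderAt faceRot a k × 3 ≤ k
           × (∀ i j → i < j → j < k →
                vert (iter faceRot i a) ≢ vert (iter faceRot j a)))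
      × (∀ a → ¬ SameFace a (r₂ a))

    Induces : (Fin N → Fin N) → (W → W) → Set
    Induces g h = ∀ a → vert (g a) ≡ h (vert a)

    InducedGroupIs : ((Fin N → Fin N) → Set) → ((W → W) → Set) → Set
    InducedGroupIs P H =
      (∀ g → P g → Σ (W → W) λ h → H h × Induces g h)
      × (∀ h → H h → Σ (Fin N → Fin N) λ g → P g × Induces g h)

-- Conjugation by ψ, which reflects the fibre j ↦ - 1 - j over every odd layer i, turns σ₁ and
-- σ₂ into σ₁′ = ρ₁ρ₀ and σ₂′ = ρ₂ρ₁, where ρ₀, ρ₁, ρ₂ are affine involutions of ℤ_n × ℤ_m.
-- These generate the group Aff of all maps (i , j) ↦ (± i + u , ± j + a + b i), of order 4nm².
-- Taking Aff as the set of flags, with r₀, r₁, r₂ the right multiplications by ρ₀, ρ₁, ρ₂,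
-- gives a map whose automorphisms are the left multiplications. The stabiliser ⟨ρ₁, ρ₂⟩ of
-- the origin is the vertex stabiliser, so the vertices are the points of ℤ_n × ℤ_m, and ρ₀
-- moves the origin to a neighbour in C_n[mK₁]. The face and vertex rotations
-- ρ₀ρ₁ : (i , j) ↦ (i - 1 , - 1 - j) and ρ₁ρ₂ : (i , j) ↦ (- i , 2 i - j) have orders 2n and 2m;
-- ρ₀ and ρ₁ preserve sg δ · b (mod m) while ρ₂ changes it by ± 2, so the two faces at an edge
-- differ. Finally (ρ₀ρ₁)ⁿ (ρ₁ρ₂)ᵐ ρ₁ is a word of odd length whose value (i , j) ↦ (i , j - 1)
-- has odd order m, so the flag graph is not bipartite.

module Submission where

open import Data.Bool using (Bool; true; false; not; _xor_; if_then_else_; T)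
import Data.Bool.Properties as Boolₚ
open import Data.Empty using (⊥-elim)
open import Data.Fin as Fin using (Fin; toℕ)
import Data.Fin.Properties as Finₚ
open import Data.Fin.Properties using (2↔Bool; *↔×)
open import Data.Integer as ℤ using (ℤ; +_; -[1+_]; _+_; -_; _-_; -1ℤ) renaming (_*_ to _·_)
import Data.Integer.Properties as ℤₚ
open import Data.Integer.DivMod using (_%ℕ_; _/ℕ_; a≡a%ℕn+[a/ℕn]*n)
open import Data.Integer.Tactic.RingSolver using (solve-∀)
open import Data.Nat as ℕ using (ℕ; zero; suc; _*_; _<_; _≤_; _∸_; z≤n; s≤s)
import Data.Nat.Properties as ℕₚ
import Data.Nat.Tactic.RingSolver as ℕSolver
open import Data.Product using (Σ; ∃; _×_; _,_; proj₁; proj₂)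
open import Data.Product.Function.NonDependent.Propositional using (_×-↔_)
open import Data.Sum as Sum using (_⊎_; inj₁; inj₂)
open import Data.Unit using (tt)
open import Function using (id; _∘_; _↔_; Inverse)
open import Function.Construct.Composition using (_↔-∘_)
open import Function.Construct.Identity using (↔-id)
open import Level using (0ℓ)
open import Relation.Binary.Bundles using (Setoid)
open import Relation.Binary.Construct.Closure.ReflexiveTransitive
  using (Star; ε; _◅_; _◅◅_; gmap; fold; reverse; return)
open import Relation.Binary.PropositionalEquality hiding ([_])
import Relation.Binary.Reasoning.Setoid as SetoidReasoning
open import Relation.Nullary using (¬_)

open import Defs
infix 4 _≋⟨_⟩_
infixr 4 _,≋_
record _≋⟨_⟩_ (x : ℤ) (k : ℕ) (y : ℤ) : Set where
  constructor _,≋_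
  field
    quotient : ℤ
    equation : x ≡ y + quotient · + k

private
  add-multiple-of : ∀ y q K → y ≡ (y + q · K) + (- q) · K
  add-multiple-of = solve-∀

module _ {k : ℕ} where

  ≋-refl : ∀ {x} → x ≋⟨ k ⟩ x
  ≋-refl {x} = + 0 ,≋ lemma x (+ k)
    where
    lemma : ∀ x K → x ≡ x + + 0 · K
    lemma = solve-∀

  ≋-reflexive : ∀ {x y} → x ≡ y → x ≋⟨ k ⟩ y
  ≋-reflexive refl = ≋-refl

  ≋-sym : ∀ {x y} → x ≋⟨ k ⟩ y → y ≋⟨ k ⟩ x
  ≋-sym {y = y} (q ,≋ refl) = - q ,≋ add-multiple-of y q (+ k)

  ≋-trans : ∀ {x y z} → x ≋⟨ k ⟩ y → y ≋⟨ k ⟩ z → x ≋⟨ k ⟩ z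
  ≋-trans {z = z} (q ,≋ refl) (r ,≋ refl) = r + q ,≋ lemma z r q (+ k)
    where
    lemma : ∀ z r q K → (z + r · K) + q · K ≡ z + (r + q) · K
    lemma = solve-∀

  ≋-+ : ∀ {x x′ y y′} → x ≋⟨ k ⟩ x′ → y ≋⟨ k ⟩ y′ → x + y ≋⟨ k ⟩ x′ + y′
  ≋-+ {x′ = x′} {y′ = y′} (q ,≋ refl) (r ,≋ refl) = q + r ,≋ lemma x′ y′ q r (+ k)
    where
    lemma : ∀ x y q r K → (x + q · K) + (y + r · K) ≡ (x + y) + (q + r) · K
    lemma = solve-∀

  ≋-· : ∀ {x x′ y y′} → x ≋⟨ k ⟩ x′ → y ≋⟨ k ⟩ y′ → x · y ≋⟨ k ⟩ x′ · y′
  ≋-· {x′ = x′} {y′ = y′} (q ,≋ refl) (r ,≋ refl) =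
    x′ · r + q · y′ + q · r · + k ,≋ lemma x′ y′ q r (+ k)
    where
    lemma : ∀ x y q r K →
            (x + q · K) · (y + r · K) ≡ x · y + (x · r + q · y + q · r · K) · K
    lemma = solve-∀

  ≋-neg : ∀ {x x′} → x ≋⟨ k ⟩ x′ → - x ≋⟨ k ⟩ - x′
  ≋-neg {x′ = x′} (q ,≋ refl) = - q ,≋ lemma x′ q (+ k)
    where
    lemma : ∀ x q K → - (x + q · K) ≡ - x + (- q) · K
    lemma = solve-∀

  ≋-·ˡ : ∀ c {y y′} → y ≋⟨ k ⟩ y′ → c · y ≋⟨ k ⟩ c · y′
  ≋-·ˡ c = ≋-· (≋-refl {c})

  ≋-·ʳ : ∀ c {x x′} → x ≋⟨ k ⟩ x′ → x · c ≋⟨ k ⟩ x′ · c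
  ≋-·ʳ c p = ≋-· p (≋-refl {c})

  ≋-+ˡ : ∀ c {y y′} → y ≋⟨ k ⟩ y′ → c + y ≋⟨ k ⟩ c + y′
  ≋-+ˡ c = ≋-+ (≋-refl {c})

  ≋-+ʳ : ∀ c {x x′} → x ≋⟨ k ⟩ x′ → x + c ≋⟨ k ⟩ x′ + c
  ≋-+ʳ c p = ≋-+ p (≋-refl {c})

  modulus≋0 : + k ≋⟨ k ⟩ + 0
  modulus≋0 = + 1 ,≋ lemma (+ k)
    where
    lemma : ∀ K → K ≡ + 0 + + 1 · K
    lemma = solve-∀

  ≋-setoid : Setoid 0ℓ 0ℓ
  ≋-setoid = record
    { Carrier = ℤ ; _≈_ = λ x y → x ≋⟨ k ⟩ y
    ; isEquivalence = record { refl = ≋-refl ; sym = ≋-sym ; trans = ≋-trans } }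

  module ≋-Reasoning = SetoidReasoning ≋-setoid

≋-weaken : ∀ {x y} s k → x ≋⟨ s * k ⟩ y → x ≋⟨ k ⟩ y
≋-weaken {y = y} s k (q ,≋ refl) = q · + s ,≋ (begin
  y + q · + (s * k)     ≡⟨ cong (λ c → y + q · c) (ℤₚ.pos-* s k) ⟩
  y + q · (+ s · + k)   ≡⟨ lemma y q (+ s) (+ k) ⟩
  y + q · + s · + k     ∎)
  where
  open ≡-Reasoning
  lemma : ∀ y q S K → y + q · (S · K) ≡ y + q · S · K
  lemma = solve-∀

≋-+-cancelˡ : ∀ {K} c {x y} → c + x ≋⟨ K ⟩ c + y → x ≋⟨ K ⟩ y
≋-+-cancelˡ c {x} {y} c+x≋c+y =
  ≋-trans (≋-reflexive (sym (lemma c x))) (≋-trans (≋-+ˡ (- c) c+x≋c+y) (≋-reflexive (lemma c y)))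
  where
  lemma : ∀ c x → - c + (c + x) ≡ x
  lemma = solve-∀

private
  no-positive-multiple : ∀ {K r₁} r₂ q → r₁ < K → + r₁ ≢ + r₂ + + suc q · + K
  no-positive-multiple {K} {r₁} r₂ q lt eq = ℕₚ.<⇒≱ lt (subst (K ≤_) (sym r₁≡) K≤)
    where
    r₁≡ : r₁ ≡ r₂ ℕ.+ suc q * K
    r₁≡ = ℤₚ.+-injective (trans eq (trans (cong (λ c → + r₂ + c) (sym (ℤₚ.pos-* (suc q) K)))
                                          (sym (ℤₚ.pos-+ r₂ (suc q * K)))))
    K≤ : K ≤ r₂ ℕ.+ suc q * K
    K≤ = ℕₚ.≤-trans (ℕₚ.m≤n*m K (suc q)) (ℕₚ.m≤n+m (suc q * K) r₂)

≋⇒≡ : ∀ {K} r₁ r₂ → r₁ < K → r₂ < K → + r₁ ≋⟨ K ⟩ + r₂ → r₁ ≡ r₂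
≋⇒≡ {K} r₁ r₂ _ _ (+ zero ,≋ eq) =
  ℤₚ.+-injective (trans eq (trans (cong (λ c → + r₂ + c) (ℤₚ.*-zeroˡ (+ K))) (ℤₚ.+-identityʳ (+ r₂))))
≋⇒≡ r₁ r₂ r₁<K _ (+ suc q ,≋ eq) = ⊥-elim (no-positive-multiple r₂ q r₁<K eq)
≋⇒≡ {K} r₁ r₂ _ r₂<K (-[1+ q ] ,≋ eq) =
  ⊥-elim (no-positive-multiple r₁ q r₂<K
    (trans (add-multiple-of (+ r₂) -[1+ q ] (+ K)) (cong (λ c → c + + suc q · + K) (sym eq))))

module _ {k : ℕ} where

  ι-reduce : (w : Fin (suc k)) (x : ℤ) → ι (reduce w x) ≋⟨ suc k ⟩ x
  ι-reduce w x = - (x /ℕ suc k) ,≋ (begin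
    + toℕ (reduce w x)                            ≡⟨ cong +_ (Finₚ.toℕ-fromℕ< _) ⟩
    + (x %ℕ suc k)                                ≡⟨ lemma x _ (x /ℕ suc k) (+ suc k) (a≡a%ℕn+[a/ℕn]*n x (suc k)) ⟩
    x + - (x /ℕ suc k) · + suc k                  ∎)
    where
    open ≡-Reasoning
    lemma : ∀ x r d K → x ≡ r + d · K → r ≡ x + (- d) · K
    lemma x r d K refl = add-multiple-of r d K

  reduce-cong : (w w′ : Fin (suc k)) {x y : ℤ} → x ≋⟨ suc k ⟩ y → reduce w x ≡ reduce w′ y
  reduce-cong w w′ {x} {y} p = Finₚ.toℕ-injective
    (≋⇒≡ _ _ (Finₚ.toℕ<n (reduce w x)) (Finₚ.toℕ<n (reduce w′ y))
      (≋-trans (ι-reduce w x) (≋-trans p (≋-sym (ι-reduce w′ y)))))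

  reduce-ι : (w x : Fin (suc k)) → reduce w (ι x) ≡ x
  reduce-ι w x = Finₚ.toℕ-injective
    (≋⇒≡ _ _ (Finₚ.toℕ<n (reduce w (ι x))) (Finₚ.toℕ<n x) (ι-reduce w (ι x)))

  reduce-≋ι : (w : Fin (suc k)) {x : ℤ} {y : Fin (suc k)} → x ≋⟨ suc k ⟩ ι y → reduce w x ≡ y
  reduce-≋ι w {x} {y} p = trans (reduce-cong w w p) (reduce-ι w y)

  toℕ-reduce : (w : Fin (suc k)) {x : ℤ} {r : ℕ} → r < suc k → x ≋⟨ suc k ⟩ + r →
               toℕ (reduce w x) ≡ r
  toℕ-reduce w {x} r<K x≋r = ≋⇒≡ _ _ (Finₚ.toℕ<n (reduce w x)) r<K (≋-trans (ι-reduce w x) x≋r)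

  toℕ-r : (i : Fin (suc k)) → suc (toℕ i) ≢ suc k → toℕ (r i) ≡ suc (toℕ i)
  toℕ-r i not-last = toℕ-reduce i (ℕₚ.≤∧≢⇒< (Finₚ.toℕ<n i) not-last)
                                  (≋-reflexive (cong +_ (ℕₚ.+-comm (toℕ i) 1)))

  toℕ-r-last : (i : Fin (suc k)) → suc (toℕ i) ≡ suc k → toℕ (r i) ≡ 0
  toℕ-r-last i last = toℕ-reduce i (s≤s z≤n)
    (≋-trans (≋-reflexive (cong +_ (trans (ℕₚ.+-comm (toℕ i) 1) last))) modulus≋0)

  toℕ-z : (i : Fin k) → toℕ (z (Fin.suc i)) ≡ suc k ∸ suc (toℕ i)
  toℕ-z i = toℕ-reduce (Fin.suc i) (ℕₚ.∸-monoʳ-< {o = 0} (s≤s z≤n) tᵢ≤K)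
    (≋-sym (begin
      + (suc k ∸ tᵢ)          ≡⟨ sym (ℤₚ.⊖-≥ tᵢ≤K) ⟩
      suc k ℤ.⊖ tᵢ            ≡⟨ sym (ℤₚ.[+m]-[+n]≡m⊖n (suc k) tᵢ) ⟩
      + suc k - + tᵢ          ≈⟨ ≋-+ʳ (- + tᵢ) modulus≋0 ⟩
      + 0 - + tᵢ              ≡⟨ ℤₚ.+-identityˡ (- + tᵢ) ⟩
      - + tᵢ                  ∎))
    where
    open ≋-Reasoning
    tᵢ : ℕ
    tᵢ = suc (toℕ i)
    tᵢ≤K : tᵢ ≤ suc k
    tᵢ≤K = ℕₚ.<⇒≤ (Finₚ.toℕ<n (Fin.suc i))

pos-odd : ∀ p → + suc (2 * p) ≡ + 1 + + 2 · + p
pos-odd p = trans (ℤₚ.pos-+ 1 (2 * p)) (cong (λ c → + 1 + c) (ℤₚ.pos-* 2 p))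

-- p + 1 is the inverse of 2 modulo 2p + 1.
≋-halve : ∀ {K} p → K ≡ suc (2 * p) → ∀ {x y} → + 2 · x ≋⟨ K ⟩ + 2 · y → x ≋⟨ K ⟩ y
≋-halve {K} p refl {x} {y} 2x≋2y =
  ≋-trans (≋-sym (half x)) (≋-trans (≋-·ˡ (+ suc p) 2x≋2y) (half y))
  where
  lemma : ∀ x P → (+ 1 + P) · (+ 2 · x) ≡ x + x · (+ 1 + + 2 · P)
  lemma = solve-∀
  half : ∀ x → + suc p · (+ 2 · x) ≋⟨ K ⟩ x
  half x = x ,≋ trans (lemma x (+ p)) (cong (λ c → x + x · c) (sym (pos-odd p)))

sg : Bool → ℤ
sg false = + 1
sg true  = -1ℤ

sg-xor : ∀ x y → sg (x xor y) ≡ sg x · sg y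
sg-xor false false = refl
sg-xor false true  = refl
sg-xor true  false = refl
sg-xor true  true  = refl

sg-square : ∀ d → sg d · sg d ≡ + 1
sg-square false = refl
sg-square true  = refl

x-x·sg² : ∀ d x → x - x · (sg d · sg d) ≡ + 0
x-x·sg² d x rewrite sg-square d = trans (cong (_-_ x) (ℤₚ.*-identityʳ x)) (ℤₚ.+-inverseʳ x)

odd : ℕ → Bool
odd zero    = false
odd (suc k) = not (odd k)

odd-+ : ∀ a b → odd (a ℕ.+ b) ≡ odd a xor odd b
odd-+ zero    b = refl
odd-+ (suc a) b = trans (cong not (odd-+ a b)) (Boolₚ.not-distribˡ-xor (odd a) (odd b))

odd-double : ∀ c → odd (c ℕ.+ c) ≡ false
odd-double c = trans (odd-+ c c) (Boolₚ.xor-same (odd c))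

odd-2* : ∀ p → odd (2 * p) ≡ false
odd-2* p = trans (cong (λ c → odd (p ℕ.+ c)) (ℕₚ.+-identityʳ p)) (odd-double p)

-1^≡sg∘odd : ∀ k → -1ℤ ℤ.^ k ≡ sg (odd k)
-1^≡sg∘odd zero = refl
-1^≡sg∘odd (suc k) rewrite -1^≡sg∘odd k with odd k
... | false = refl
... | true  = refl

even-or-odd : ∀ i → ∃ λ c → (i ≡ c ℕ.+ c) ⊎ (i ≡ suc (c ℕ.+ c))
even-or-odd zero = 0 , inj₁ refl
even-or-odd (suc i) with even-or-odd i
... | c , inj₁ refl = c , inj₂ refl
... | c , inj₂ refl = suc c , inj₁ (cong suc (sym (ℕₚ.+-suc c c)))

private
  even≢odd : ∀ c c′ → odd (c ℕ.+ c) ≢ odd (suc (c′ ℕ.+ c′))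
  even≢odd c c′ eq with trans (sym (odd-double c)) (trans eq (cong not (odd-double c′)))
  ... | ()

  half-< : ∀ {c K} → c ℕ.+ c < 2 * K → c < K
  half-< {c} {K} lt = ℕₚ.≰⇒> λ K≤c →
    ℕₚ.<⇒≱ lt (subst (_≤ c ℕ.+ c) (cong (K ℕ.+_) (sym (ℕₚ.+-identityʳ K))) (ℕₚ.+-mono-≤ K≤c K≤c))

  halves-≡ : ∀ {K} p → K ≡ suc (2 * p) → ∀ c c′ → c ℕ.+ c < 2 * K → c′ ℕ.+ c′ < 2 * K →
             + (c ℕ.+ c) ≋⟨ K ⟩ + (c′ ℕ.+ c′) → c ≡ c′
  halves-≡ {K} p K-odd c c′ l l′ eq = ≋⇒≡ c c′ (half-< l) (half-< l′)
    (≋-halve p K-odd (subst₂ (λ x y → x ≋⟨ K ⟩ y) (pos-double c) (pos-double c′) eq))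
    where
    lemma : ∀ x → x + x ≡ + 2 · x
    lemma = solve-∀
    pos-double : ∀ c → + (c ℕ.+ c) ≡ + 2 · + c
    pos-double c = trans (ℤₚ.pos-+ c c) (lemma (+ c))

≋-same-parity⇒≡ : ∀ {K} p → K ≡ suc (2 * p) → ∀ {i j} → i < 2 * K → j < 2 * K →
                  odd i ≡ odd j → + i ≋⟨ K ⟩ + j → i ≡ j
≋-same-parity⇒≡ p K-odd {i} {j} i< j< same i≋j with even-or-odd i | even-or-odd j
... | c , inj₁ refl | c′ , inj₁ refl = cong (λ x → x ℕ.+ x) (halves-≡ p K-odd c c′ i< j< i≋j)
... | c , inj₂ refl | c′ , inj₂ refl = cong (λ x → suc (x ℕ.+ x))
  (halves-≡ p K-odd c c′ (ℕₚ.<-trans (ℕₚ.n<1+n _) i<) (ℕₚ.<-trans (ℕₚ.n<1+n _) j<) (≋-+-cancelˡ (+ 1) i≋j))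
... | c , inj₁ refl | c′ , inj₂ refl = ⊥-elim (even≢odd c c′ same)
... | c , inj₂ refl | c′ , inj₁ refl = ⊥-elim (even≢odd c′ c (sym same))

module _ {A : Set} {T : A → A → Set} where

  Star-respects : (P : A → Set) → (∀ {x y} → T x y → P x → P y) →
                  ∀ {x y} → Star T x y → P x → P y
  Star-respects P step = fold (λ x y → P x → P y) (λ t f → f ∘ step t) id

module Dihedral {A : Set} (p q : A → A)
                (p-invol : ∀ x → p (p x) ≡ x) (q-invol : ∀ x → q (q x) ≡ x) where

  rot : A → A
  rot = q ∘ p

  Step : A → A → Set
  Step x y = (y ≡ p x) ⊎ (y ≡ q x)

  RotOrbit : A → A → Set
  RotOrbit a y = ∃ λ k → (y ≡ iter rot k a) ⊎ (y ≡ p (iter rot k a))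

  star⇒rotOrbit : ∀ {P a b} → iter rot (suc P) a ≡ a → Star Step a b → RotOrbit a b
  star⇒rotOrbit {P} {a} period path = Star-respects (RotOrbit a) step path (0 , inj₁ refl)
    where
    step : ∀ {x y} → Step x y → RotOrbit a x → RotOrbit a y
    step (inj₁ refl) (k , inj₁ refl) = k , inj₂ refl
    step (inj₁ refl) (k , inj₂ refl) = k , inj₁ (p-invol _)
    step (inj₂ refl) (zero , inj₁ refl) = P , inj₂ (trans (cong q (sym period)) (q-invol _))
    step (inj₂ refl) (suc k , inj₁ refl) = k , inj₂ (q-invol _)
    step (inj₂ refl) (k , inj₂ refl) = suc k , inj₁ refl

  iter-rot-shift : ∀ k x → iter rot k (rot x) ≡ rot (iter rot k x)
  iter-rot-shift zero    x = refl
  iter-rot-shift (suc k) x = cong rot (iter-rot-shift k x)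

  module _ {g : A → A} (g-p : ∀ x → g (p x) ≡ p (g x)) (g-q : ∀ x → g (q x) ≡ q (g x)) where

    iter-rot-comm : ∀ k x → g (iter rot k x) ≡ iter rot k (g x)
    iter-rot-comm zero x = refl
    iter-rot-comm (suc k) x =
      trans (g-q _) (trans (cong q (g-p _)) (cong rot (iter-rot-comm k x)))

    iter-agrees : ∀ {a} → g a ≡ rot a → ∀ k → iter g k a ≡ iter rot k a
    iter-agrees ga zero = refl
    iter-agrees {a} ga (suc k) = begin
      g (iter g k a)        ≡⟨ cong g (iter-agrees ga k) ⟩
      g (iter rot k a)      ≡⟨ iter-rot-comm k a ⟩
      iter rot k (g a)      ≡⟨ cong (iter rot k) ga ⟩
      iter rot k (rot a)    ≡⟨ iter-rot-shift k a ⟩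
      rot (iter rot k a)    ∎
      where open ≡-Reasoning

    reached-by-rotation : ∀ {P a b} → g a ≡ rot a → iter rot (suc P) a ≡ a → Star Step a b →
                          ∃ λ k → (iter g k a ≡ b) ⊎ (iter g k a ≡ q b)
    reached-by-rotation {P} ga period path with star⇒rotOrbit {P} period path
    ... | k , inj₁ refl = k , inj₁ (iter-agrees ga k)
    ... | k , inj₂ refl = suc k , inj₂ (iter-agrees ga (suc k))

module _ (M : FlagMap) where
  open FlagMap M

  aut-r₀ : ∀ {g} → IsAut M g → ∀ a → g (r₀ a) ≡ r₀ (g a)
  aut-r₀ (_ , c , _ , _) = c

  aut-r₁ : ∀ {g} → IsAut M g → ∀ a → g (r₁ a) ≡ r₁ (g a)
  aut-r₁ (_ , _ , c , _) = c

  aut-r₂ : ∀ {g} → IsAut M g → ∀ a → g (r₂ a) ≡ r₂ (g a)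
  aut-r₂ (_ , _ , _ , c) = c

  isAut-id : IsAut M id
  isAut-id = (id , (λ _ → refl) , (λ _ → refl)) , (λ _ → refl) , (λ _ → refl) , (λ _ → refl)

  isAut-∘ : ∀ {g h} → IsAut M g → IsAut M h → IsAut M (g ∘ h)
  isAut-∘ {g} {h} ((g⁻ , gl , gr) , g₀ , g₁ , g₂) ((h⁻ , hl , hr) , h₀ , h₁ , h₂) =
    (h⁻ ∘ g⁻ , (λ x → trans (cong h⁻ (gl (h x))) (hl x))
             , (λ x → trans (cong g (hr (g⁻ x))) (gr x))) ,
    (λ x → trans (cong g (h₀ x)) (g₀ (h x))) ,
    (λ x → trans (cong g (h₁ x)) (g₁ (h x))) ,
    (λ x → trans (cong g (h₂ x)) (g₂ (h x)))

  isAut-inverse : ∀ {g g⁻} → IsAut M g → (∀ x → g⁻ (g x) ≡ x) → (∀ x → g (g⁻ x) ≡ x) →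
                  IsAut M g⁻
  isAut-inverse {g} {g⁻} (_ , c₀ , c₁ , c₂) l r =
    (g , r , l) , commutes r₀ c₀ , commutes r₁ c₁ , commutes r₂ c₂
    where
    commutes : (ρ : Fin N → Fin N) → (∀ x → g (ρ x) ≡ ρ (g x)) → ∀ x → g⁻ (ρ x) ≡ ρ (g⁻ x)
    commutes ρ c x = trans (cong (g⁻ ∘ ρ) (sym (r x))) (trans (cong g⁻ (sym (c (g⁻ x)))) (l (ρ (g⁻ x))))

  isAut-≗ : ∀ {g h} → IsAut M g → (∀ x → g x ≡ h x) → IsAut M h
  isAut-≗ {g} {h} ((g⁻ , l , r) , c₀ , c₁ , c₂) g≗h =
    (g⁻ , (λ x → trans (cong g⁻ (sym (g≗h x))) (l x)) , (λ x → trans (sym (g≗h (g⁻ x))) (r x))) ,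
    commutes r₀ c₀ , commutes r₁ c₁ , commutes r₂ c₂
    where
    commutes : (ρ : Fin N → Fin N) → (∀ x → g (ρ x) ≡ ρ (g x)) → ∀ x → h (ρ x) ≡ ρ (h x)
    commutes ρ c x = trans (sym (g≗h (ρ x))) (trans (c x) (cong ρ (g≗h x)))

  ⟨⟩-isAut : ∀ {f g h} → IsAut M f → IsAut M g → ⟨ f , g ⟩ h → IsAut M h
  ⟨⟩-isAut F G gen₁          = F
  ⟨⟩-isAut F G gen₂          = G
  ⟨⟩-isAut F G one           = isAut-id
  ⟨⟩-isAut F G (mul dh dk)   = isAut-∘ (⟨⟩-isAut F G dk) (⟨⟩-isAut F G dh)
  ⟨⟩-isAut F G (inv dh l r)  = isAut-inverse (⟨⟩-isAut F G dh) l r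
  ⟨⟩-isAut F G (ext dh h≗k) = isAut-≗ (⟨⟩-isAut F G dh) h≗k

  aut-unique : ∀ {g h a} → IsAut M g → IsAut M h → g a ≡ h a → ∀ b → g b ≡ h b
  aut-unique {g} {h} {a} G H ga≡ha b =
    Star-respects (λ x → g x ≡ h x) step (connected a b) ga≡ha
    where
    step : ∀ {x y} → (y ≡ r₀ x) ⊎ (y ≡ r₁ x) ⊎ (y ≡ r₂ x) → g x ≡ h x → g y ≡ h y
    step {x} (inj₁ refl)        eq = trans (aut-r₀ G x) (trans (cong r₀ eq) (sym (aut-r₀ H x)))
    step {x} (inj₂ (inj₁ refl)) eq = trans (aut-r₁ G x) (trans (cong r₁ eq) (sym (aut-r₁ H x)))
    step {x} (inj₂ (inj₂ refl)) eq = trans (aut-r₂ G x) (trans (cong r₂ eq) (sym (aut-r₂ H x)))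

  period : ∀ {f a k} → OrderAt M f a k → ∃ λ P → iter f (suc P) a ≡ a
  period {k = suc P} (_ , fixed , _) = P , fixed

  rotary : ∀ {p q} → HasType M p q →
           (∀ a → Σ (Fin N → Fin N) λ g → IsAut M g × g a ≡ vertRot M a) →
           (∀ a → Σ (Fin N → Fin N) λ g → IsAut M g × g a ≡ faceRot M a) →
           Rotary M
  rotary type vertex-rotation face-rotation = around-vertex , around-face
    where
    module V = Dihedral r₁ r₂ r₁-inv r₂-inv
    module F = Dihedral r₀ r₁ r₀-inv r₁-inv
    around-vertex : ∀ a → Σ (Fin N → Fin N) λ g → IsAut M g × SameVertex M a (g a)
                    × (∀ b → SameVertex M a b → ∃ λ k → SameEdge M (iter g k a) b)
    around-vertex a with vertex-rotation a | period (proj₂ (type a))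
    ... | g , G , ga | P , per = g , G , inj₁ refl ◅ inj₂ ga ◅ ε , edge-reached
      where
      edge-reached : ∀ b → SameVertex M a b → ∃ λ k → SameEdge M (iter g k a) b
      edge-reached b path with V.reached-by-rotation (aut-r₁ G) (aut-r₂ G) {P} ga per path
      ... | k , inj₁ refl = k , ε
      ... | k , inj₂ eq = k , return (inj₂ (sym (trans (cong r₂ eq) (r₂-inv b))))
    around-face : ∀ a → Σ (Fin N → Fin N) λ g → IsAut M g × SameFace M a (g a)
                  × (∀ b → SameFace M a b → ∃ λ k → SameVertex M (iter g k a) b)
    around-face a with face-rotation a | period (proj₁ (type a))
    ... | g , G , ga | P , per = g , G , inj₁ refl ◅ inj₂ ga ◅ ε , vertex-reached
      where
      vertex-reached : ∀ b → SameFace M a b → ∃ λ k → SameVertex M (iter g k a) b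
      vertex-reached b path with F.reached-by-rotation (aut-r₀ G) (aut-r₁ G) {P} ga per path
      ... | k , inj₁ refl = k , ε
      ... | k , inj₂ eq = k , return (inj₁ (sym (trans (cong r₁ eq) (r₁-inv b))))

module Construction (mj sk : ℕ) where

  m s n : ℕ
  m = suc (2 * mj)
  s = suc (2 * sk)
  n = s * m

  n′ : ℕ
  n′ = mj ℕ.+ sk * m

  n-odd : n ≡ suc (2 * n′)
  n-odd = cong suc (lemma mj sk)
    where
    lemma : ∀ a b → 2 * a ℕ.+ 2 * b * suc (2 * a) ≡ 2 * (a ℕ.+ b * suc (2 * a))
    lemma = ℕSolver.solve-∀

  ≋n⇒≋m : ∀ {x y} → x ≋⟨ n ⟩ y → x ≋⟨ m ⟩ y
  ≋n⇒≋m = ≋-weaken s m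

  -- mk δ u f a b stands for (i , j) ↦ (sg δ · i + u , sg f · j + a + b · i), and g ∙ h for
  -- "first h, then g"; see act below.
  record Aff : Set where
    constructor mk
    field
      δ : Bool
      u : ℤ
      f : Bool
      a : ℤ
      b : ℤ
  open Aff public

  mk-cong : ∀ {δ δ′ u u′ f f′ a a′ b b′} → δ ≡ δ′ → u ≡ u′ → f ≡ f′ → a ≡ a′ → b ≡ b′ →
            mk δ u f a b ≡ mk δ′ u′ f′ a′ b′
  mk-cong refl refl refl refl refl = refl

  infixl 7 _∙_
  _∙_ : Aff → Aff → Aff
  g ∙ h = mk (δ g xor δ h) (sg (δ g) · u h + u g) (f g xor f h)
             (sg (f g) · a h + a g + b g · u h) (sg (f g) · b h + b g · sg (δ h))

  e : Aff
  e = mk false (+ 0) false (+ 0) (+ 0)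

  infix 8 _⁻¹
  _⁻¹ : Aff → Aff
  g ⁻¹ = mk (δ g) (- (sg (δ g) · u g)) (f g)
            (- (sg (f g) · a g) + sg (f g) · b g · sg (δ g) · u g) (- (sg (f g) · b g · sg (δ g)))

  ∙-assoc : ∀ g h k → (g ∙ h) ∙ k ≡ g ∙ (h ∙ k)
  ∙-assoc (mk δ₁ u₁ f₁ a₁ b₁) (mk δ₂ u₂ f₂ a₂ b₂) (mk δ₃ u₃ f₃ a₃ b₃) =
    mk-cong (Boolₚ.xor-assoc δ₁ δ₂ δ₃)
      (trans (cong (λ c → c · u₃ + _) (sg-xor δ₁ δ₂)) (lemma-u (sg δ₁) (sg δ₂) u₁ u₂ u₃))
      (Boolₚ.xor-assoc f₁ f₂ f₃)
      (trans (cong (λ c → c · a₃ + _ + _) (sg-xor f₁ f₂))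
             (lemma-a (sg f₁) (sg f₂) (sg δ₂) u₂ u₃ a₁ a₂ a₃ b₁ b₂))
      (trans (cong (λ c → c · b₃ + _) (sg-xor f₁ f₂))
        (trans (lemma-b (sg f₁) (sg f₂) (sg δ₂) (sg δ₃) b₁ b₂ b₃)
               (cong (λ c → sg f₁ · (sg f₂ · b₃ + b₂ · sg δ₃) + b₁ · c) (sym (sg-xor δ₂ δ₃)))))
    where
    lemma-u : ∀ D₁ D₂ u₁ u₂ u₃ → D₁ · D₂ · u₃ + (D₁ · u₂ + u₁) ≡ D₁ · (D₂ · u₃ + u₂) + u₁
    lemma-u = solve-∀
    lemma-a : ∀ F₁ F₂ D₂ u₂ u₃ a₁ a₂ a₃ b₁ b₂ →
              F₁ · F₂ · a₃ + (F₁ · a₂ + a₁ + b₁ · u₂) + (F₁ · b₂ + b₁ · D₂) · u₃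
              ≡ F₁ · (F₂ · a₃ + a₂ + b₂ · u₃) + a₁ + b₁ · (D₂ · u₃ + u₂)
    lemma-a = solve-∀
    lemma-b : ∀ F₁ F₂ D₂ D₃ b₁ b₂ b₃ →
              F₁ · F₂ · b₃ + (F₁ · b₂ + b₁ · D₂) · D₃ ≡ F₁ · (F₂ · b₃ + b₂ · D₃) + b₁ · (D₂ · D₃)
    lemma-b = solve-∀

  ∙-identityˡ : ∀ g → e ∙ g ≡ g
  ∙-identityˡ (mk δ u f a b) = mk-cong refl (lemma-u u) refl (lemma-a a b u) (lemma-b b (sg δ))
    where
    lemma-u : ∀ u → + 1 · u + + 0 ≡ u
    lemma-u = solve-∀
    lemma-a : ∀ a b u → + 1 · a + + 0 + + 0 · u ≡ a
    lemma-a = solve-∀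
    lemma-b : ∀ b D → + 1 · b + + 0 · D ≡ b
    lemma-b = solve-∀

  ∙-identityʳ : ∀ g → g ∙ e ≡ g
  ∙-identityʳ (mk δ u f a b) =
    mk-cong (Boolₚ.xor-identityʳ δ) (lemma-u (sg δ) u) (Boolₚ.xor-identityʳ f)
            (lemma-a (sg f) a b) (lemma-b (sg f) b)
    where
    lemma-u : ∀ D u → D · + 0 + u ≡ u
    lemma-u = solve-∀
    lemma-a : ∀ F a b → F · + 0 + a + b · + 0 ≡ a
    lemma-a = solve-∀
    lemma-b : ∀ F b → F · + 0 + b · + 1 ≡ b
    lemma-b = solve-∀

  ∙-inverseˡ : ∀ g → g ⁻¹ ∙ g ≡ e
  ∙-inverseˡ (mk δ u f a b) =
    mk-cong (Boolₚ.xor-same δ) (ℤₚ.+-inverseʳ (sg δ · u)) (Boolₚ.xor-same f)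
            (lemma-a (sg f) (sg δ) u a b) (trans (lemma-b (sg f · b) (sg δ)) (x-x·sg² δ (sg f · b)))
    where
    lemma-a : ∀ F D u a b → F · a + (- (F · a) + F · b · D · u) + - (F · b · D) · u ≡ + 0
    lemma-a = solve-∀
    lemma-b : ∀ x D → x + - (x · D) · D ≡ x - x · (D · D)
    lemma-b = solve-∀

  ∙-inverseʳ : ∀ g → g ∙ g ⁻¹ ≡ e
  ∙-inverseʳ (mk δ u f a b) =
    mk-cong (Boolₚ.xor-same δ) (trans (lemma-u (sg δ) u) (x-x·sg² δ u)) (Boolₚ.xor-same f)
            (trans (lemma-a (sg f) (sg δ) u a b)
                   (cong₂ _-_ (x-x·sg² f a) (x-x·sg² f (b · sg δ · u))))
            (trans (lemma-b (sg f) b (sg δ)) (x-x·sg² f (b · sg δ)))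
    where
    lemma-u : ∀ D u → D · - (D · u) + u ≡ u - u · (D · D)
    lemma-u = solve-∀
    lemma-a : ∀ F D u a b → F · (- (F · a) + F · b · D · u) + a + b · - (D · u)
                            ≡ (a - a · (F · F)) - (b · D · u - b · D · u · (F · F))
    lemma-a = solve-∀
    lemma-b : ∀ F b D → F · - (F · b · D) + b · D ≡ b · D - b · D · (F · F)
    lemma-b = solve-∀

  infix 4 _≈_
  record _≈_ (g h : Aff) : Set where
    constructor mk≈
    field
      δ-eq : δ g ≡ δ h
      u-eq : u g ≋⟨ n ⟩ u h
      f-eq : f g ≡ f h
      a-eq : a g ≋⟨ m ⟩ a h
      b-eq : b g ≋⟨ m ⟩ b h
  open _≈_ public

  ≈-refl : ∀ {g} → g ≈ g
  ≈-refl = mk≈ refl ≋-refl refl ≋-refl ≋-refl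

  ≡⇒≈ : ∀ {g h} → g ≡ h → g ≈ h
  ≡⇒≈ refl = ≈-refl

  ≈-sym : ∀ {g h} → g ≈ h → h ≈ g
  ≈-sym (mk≈ p q r s t) = mk≈ (sym p) (≋-sym q) (sym r) (≋-sym s) (≋-sym t)

  ≈-trans : ∀ {g h k} → g ≈ h → h ≈ k → g ≈ k
  ≈-trans (mk≈ p q r s t) (mk≈ p′ q′ r′ s′ t′) =
    mk≈ (trans p p′) (≋-trans q q′) (trans r r′) (≋-trans s s′) (≋-trans t t′)

  ≈-setoid : Setoid 0ℓ 0ℓ
  ≈-setoid = record
    { Carrier = Aff ; _≈_ = _≈_
    ; isEquivalence = record { refl = ≈-refl ; sym = ≈-sym ; trans = ≈-trans } }

  module ≈-Reasoning = SetoidReasoning ≈-setoid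

  ∙-cong : ∀ {g g′ h h′} → g ≈ g′ → h ≈ h′ → g ∙ h ≈ g′ ∙ h′
  ∙-cong (mk≈ p q r s t) (mk≈ p′ q′ r′ s′ t′) =
    mk≈ (cong₂ _xor_ p p′)
        (≋-+ (≋-· (≋-reflexive (cong sg p)) q′) q)
        (cong₂ _xor_ r r′)
        (≋-+ (≋-+ (≋-· (≋-reflexive (cong sg r)) s′) s) (≋-· t (≋n⇒≋m q′)))
        (≋-+ (≋-· (≋-reflexive (cong sg r)) t′) (≋-· t (≋-reflexive (cong sg p′))))

  ∙-congˡ : ∀ g {h h′} → h ≈ h′ → g ∙ h ≈ g ∙ h′
  ∙-congˡ g = ∙-cong (≈-refl {g})

  ∙-congʳ : ∀ {g g′} h → g ≈ g′ → g ∙ h ≈ g′ ∙ h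
  ∙-congʳ h p = ∙-cong p (≈-refl {h})

  ∙-cancelˡ : ∀ g {h h′} → g ∙ h ≈ g ∙ h′ → h ≈ h′
  ∙-cancelˡ g {h} {h′} eq = begin
    h                 ≡⟨ sym (cancel h) ⟩
    g ⁻¹ ∙ (g ∙ h)    ≈⟨ ∙-congˡ (g ⁻¹) eq ⟩
    g ⁻¹ ∙ (g ∙ h′)   ≡⟨ cancel h′ ⟩
    h′                ∎
    where
    open ≈-Reasoning
    cancel : ∀ k → g ⁻¹ ∙ (g ∙ k) ≡ k
    cancel k = trans (sym (∙-assoc (g ⁻¹) g k)) (trans (cong (_∙ k) (∙-inverseˡ g)) (∙-identityˡ k))

  infixl 8 _^_
  _^_ : Aff → ℕ → Aff
  g ^ zero  = e
  g ^ suc k = g ^ k ∙ g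

  ^-cong : ∀ {g h} k → g ≈ h → g ^ k ≈ h ^ k
  ^-cong zero    _ = ≈-refl
  ^-cong (suc k) p = ∙-cong (^-cong k p) p

  -- A flag is an element of Aff up to ≈, stored as its normal form, a Code.
  Code : Set
  Code = Bool × Fin n × Bool × Fin m × Fin m

  N : ℕ
  N = 2 * (n * (2 * (m * m)))

  Flag : Set
  Flag = Fin N

  code↔ : Flag ↔ Code
  code↔ = (2↔Bool ×-↔ ((↔-id (Fin n) ×-↔ ((2↔Bool ×-↔ *↔×) ↔-∘ *↔×)) ↔-∘ *↔×)) ↔-∘ *↔×

  reduceₙ : ℤ → Fin n
  reduceₙ = reduce Fin.zero

  reduceₘ : ℤ → Fin m
  reduceₘ = reduce Fin.zero

  normalise : Aff → Code
  normalise g = δ g , reduceₙ (u g) , f g , reduceₘ (a g) , reduceₘ (b g)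

  embed : Code → Aff
  embed (δ , u , f , a , b) = mk δ (ι u) f (ι a) (ι b)

  embed-normalise : ∀ g → embed (normalise g) ≈ g
  embed-normalise g =
    mk≈ refl (ι-reduce Fin.zero (u g)) refl (ι-reduce Fin.zero (a g)) (ι-reduce Fin.zero (b g))

  normalise-embed : ∀ c → normalise (embed c) ≡ c
  normalise-embed (δ , u , f , a , b)
    rewrite reduce-ι Fin.zero u | reduce-ι Fin.zero a | reduce-ι Fin.zero b = refl

  normalise-cong : ∀ {g h} → g ≈ h → normalise g ≡ normalise h
  normalise-cong (mk≈ refl u≋ refl a≋ b≋)
    rewrite reduce-cong Fin.zero Fin.zero u≋
          | reduce-cong Fin.zero Fin.zero a≋
          | reduce-cong Fin.zero Fin.zero b≋ = refl

  abstract
    [_] : Aff → Flag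
    [ g ] = Inverse.from code↔ (normalise g)

    elt : Flag → Aff
    elt x = embed (Inverse.to code↔ x)

    elt-[] : ∀ g → elt [ g ] ≈ g
    elt-[] g = subst (λ c → embed c ≈ g) (sym (Inverse.strictlyInverseˡ code↔ (normalise g)))
                     (embed-normalise g)

    []-elt : ∀ x → [ elt x ] ≡ x
    []-elt x = trans (cong (Inverse.from code↔) (normalise-embed (Inverse.to code↔ x)))
                     (Inverse.strictlyInverseʳ code↔ x)

    []-cong : ∀ {g h} → g ≈ h → [ g ] ≡ [ h ]
    []-cong p = cong (Inverse.from code↔) (normalise-cong p)

  elt-injective : ∀ {x y} → elt x ≈ elt y → x ≡ y
  elt-injective {x} {y} p = trans (sym ([]-elt x)) (trans ([]-cong p) ([]-elt y))

  elt≈⇒≡[] : ∀ {x g} → elt x ≈ g → x ≡ [ g ]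
  elt≈⇒≡[] {x} p = trans (sym ([]-elt x)) ([]-cong p)

  ρ₀ ρ₁ ρ₂ σ₁′ σ₂′ : Aff
  ρ₀ = mk true -1ℤ true -1ℤ (+ 0)
  ρ₁ = mk true (+ 0) false (+ 0) (+ 0)
  ρ₂ = mk false (+ 0) true (+ 0) (+ 2)
  σ₁′ = ρ₁ ∙ ρ₀
  σ₂′ = ρ₂ ∙ ρ₁

  abstract
    R : Aff → Flag → Flag
    R ρ x = [ elt x ∙ ρ ]

    elt-R : ∀ ρ x → elt (R ρ x) ≈ elt x ∙ ρ
    elt-R ρ x = elt-[] (elt x ∙ ρ)

    L : Aff → Flag → Flag
    L γ x = [ γ ∙ elt x ]

    elt-L : ∀ γ x → elt (L γ x) ≈ γ ∙ elt x
    elt-L γ x = elt-[] (γ ∙ elt x)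

  R₀ R₁ R₂ : Flag → Flag
  R₀ = R ρ₀
  R₁ = R ρ₁
  R₂ = R ρ₂

  R-[] : ∀ ρ g → R ρ [ g ] ≡ [ g ∙ ρ ]
  R-[] ρ g = elt≈⇒≡[] (≈-trans (elt-R ρ [ g ]) (∙-congʳ ρ (elt-[] g)))

  L-[] : ∀ γ g → L γ [ g ] ≡ [ γ ∙ g ]
  L-[] γ g = elt≈⇒≡[] (≈-trans (elt-L γ [ g ]) (∙-congˡ γ (elt-[] g)))

  elt-RR : ∀ ρ ρ′ x → elt (R ρ′ (R ρ x)) ≈ elt x ∙ (ρ ∙ ρ′)
  elt-RR ρ ρ′ x = begin
    elt (R ρ′ (R ρ x))   ≈⟨ elt-R ρ′ (R ρ x) ⟩
    elt (R ρ x) ∙ ρ′     ≈⟨ ∙-congʳ ρ′ (elt-R ρ x) ⟩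
    elt x ∙ ρ ∙ ρ′       ≡⟨ ∙-assoc (elt x) ρ ρ′ ⟩
    elt x ∙ (ρ ∙ ρ′)     ∎
    where open ≈-Reasoning

  R-involutive : ∀ ρ → ρ ∙ ρ ≡ e → ∀ x → R ρ (R ρ x) ≡ x
  R-involutive ρ ρρ≡e x = elt-injective (begin
    elt (R ρ (R ρ x))   ≈⟨ elt-RR ρ ρ x ⟩
    elt x ∙ (ρ ∙ ρ)     ≡⟨ cong (elt x ∙_) ρρ≡e ⟩
    elt x ∙ e           ≡⟨ ∙-identityʳ (elt x) ⟩
    elt x               ∎)
    where open ≈-Reasoning

  private
    xor-true-≢ : ∀ d → d xor true ≢ d
    xor-true-≢ false ()
    xor-true-≢ true  ()

  R-fixed-point-free-δ : ∀ ρ → δ ρ ≡ true → ∀ x → R ρ x ≢ x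
  R-fixed-point-free-δ ρ refl x eq =
    xor-true-≢ (δ (elt x)) (δ-eq (≈-trans (≈-sym (elt-R ρ x)) (≡⇒≈ (cong elt eq))))

  R-fixed-point-free-f : ∀ ρ → f ρ ≡ true → ∀ x → R ρ x ≢ x
  R-fixed-point-free-f ρ refl x eq =
    xor-true-≢ (f (elt x)) (f-eq (≈-trans (≈-sym (elt-R ρ x)) (≡⇒≈ (cong elt eq))))

  R₀R₂-comm : ∀ x → R₀ (R₂ x) ≡ R₂ (R₀ x)
  R₀R₂-comm x = elt-injective (≈-trans (elt-RR ρ₂ ρ₀ x) (≈-sym (elt-RR ρ₀ ρ₂ x)))

  R₀R₂-fixed-point-free : ∀ x → R₀ (R₂ x) ≢ x
  R₀R₂-fixed-point-free x eq =
    xor-true-≢ (δ (elt x)) (δ-eq (≈-trans (≈-sym (elt-RR ρ₂ ρ₀ x)) (≡⇒≈ (cong elt eq))))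

  L-R : ∀ γ ρ x → L γ (R ρ x) ≡ R ρ (L γ x)
  L-R γ ρ x = elt-injective (begin
    elt (L γ (R ρ x))    ≈⟨ elt-L γ (R ρ x) ⟩
    γ ∙ elt (R ρ x)      ≈⟨ ∙-congˡ γ (elt-R ρ x) ⟩
    γ ∙ (elt x ∙ ρ)      ≡⟨ sym (∙-assoc γ (elt x) ρ) ⟩
    γ ∙ elt x ∙ ρ        ≈⟨ ∙-congʳ ρ (elt-L γ x) ⟨
    elt (L γ x) ∙ ρ      ≈⟨ elt-R ρ (L γ x) ⟨
    elt (R ρ (L γ x))    ∎)
    where open ≈-Reasoning

  L-∙ : ∀ γ γ′ x → L γ (L γ′ x) ≡ L (γ ∙ γ′) x
  L-∙ γ γ′ x = elt-injective (begin
    elt (L γ (L γ′ x))   ≈⟨ elt-L γ (L γ′ x) ⟩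
    γ ∙ elt (L γ′ x)     ≈⟨ ∙-congˡ γ (elt-L γ′ x) ⟩
    γ ∙ (γ′ ∙ elt x)     ≡⟨ sym (∙-assoc γ γ′ (elt x)) ⟩
    γ ∙ γ′ ∙ elt x       ≈⟨ elt-L (γ ∙ γ′) x ⟨
    elt (L (γ ∙ γ′) x)   ∎)
    where open ≈-Reasoning

  L-e : ∀ x → L e x ≡ x
  L-e x = elt-injective (≈-trans (elt-L e x) (≡⇒≈ (∙-identityˡ (elt x))))

  L-inverseˡ : ∀ γ x → L (γ ⁻¹) (L γ x) ≡ x
  L-inverseˡ γ x = trans (L-∙ (γ ⁻¹) γ x) (trans (cong (λ g → L g x) (∙-inverseˡ γ)) (L-e x))

  L-inverseʳ : ∀ γ x → L γ (L (γ ⁻¹) x) ≡ x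
  L-inverseʳ γ x = trans (L-∙ γ (γ ⁻¹) x) (trans (cong (λ g → L g x) (∙-inverseʳ γ)) (L-e x))

  ι-reduceₙ : ∀ x → ι (reduceₙ x) ≋⟨ n ⟩ x
  ι-reduceₙ = ι-reduce Fin.zero

  ι-reduceₘ : ∀ x → ι (reduceₘ x) ≋⟨ m ⟩ x
  ι-reduceₘ = ι-reduce Fin.zero

  reduceₙ-cong : ∀ {x y} → x ≋⟨ n ⟩ y → reduceₙ x ≡ reduceₙ y
  reduceₙ-cong = reduce-cong Fin.zero Fin.zero

  reduceₘ-cong : ∀ {x y} → x ≋⟨ m ⟩ y → reduceₘ x ≡ reduceₘ y
  reduceₘ-cong = reduce-cong Fin.zero Fin.zero

  reduceₙ-injective : ∀ {x y} → reduceₙ x ≡ reduceₙ y → x ≋⟨ n ⟩ y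
  reduceₙ-injective {x} {y} eq =
    ≋-trans (≋-sym (ι-reduceₙ x)) (≋-trans (≋-reflexive (cong ι eq)) (ι-reduceₙ y))

  reduceₘ-injective : ∀ {x y} → reduceₘ x ≡ reduceₘ y → x ≋⟨ m ⟩ y
  reduceₘ-injective {x} {y} eq =
    ≋-trans (≋-sym (ι-reduceₘ x)) (≋-trans (≋-reflexive (cong ι eq)) (ι-reduceₘ y))

  act : Aff → V n m → V n m
  act g (i , j) = reduceₙ (sg (δ g) · ι i + u g) , reduceₘ (sg (f g) · ι j + a g + b g · ι i)

  act-cong : ∀ {g h} → g ≈ h → ∀ p → act g p ≡ act h p
  act-cong {g} (mk≈ refl u≋ refl a≋ b≋) (i , j) =
    cong₂ _,_ (reduceₙ-cong (≋-+ˡ (sg (δ g) · ι i) u≋))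
              (reduceₘ-cong (≋-+ (≋-+ˡ (sg (f g) · ι j) a≋) (≋-·ʳ (ι i) b≋)))

  act-∙ : ∀ g h p → act (g ∙ h) p ≡ act g (act h p)
  act-∙ (mk δ₁ u₁ f₁ a₁ b₁) (mk δ₂ u₂ f₂ a₂ b₂) (i , j) = cong₂ _,_
    (reduceₙ-cong (≋-trans
      (≋-reflexive (trans (cong (λ c → c · ι i + _) (sg-xor δ₁ δ₂))
                          (lemma-i (sg δ₁) (sg δ₂) (ι i) u₁ u₂)))
      (≋-+ʳ u₁ (≋-·ˡ (sg δ₁) (≋-sym (ι-reduceₙ _))))))
    (reduceₘ-cong (≋-trans
      (≋-reflexive (trans (cong (λ c → c · ι j + _ + _) (sg-xor f₁ f₂))
                          (lemma-j (sg f₁) (sg f₂) (sg δ₂) (ι j) (ι i) u₂ a₁ a₂ b₁ b₂)))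
      (≋-+ (≋-+ʳ a₁ (≋-·ˡ (sg f₁) (≋-sym (ι-reduceₘ _))))
           (≋-·ˡ b₁ (≋n⇒≋m (≋-sym (ι-reduceₙ _)))))))
    where
    lemma-i : ∀ D₁ D₂ i u₁ u₂ → D₁ · D₂ · i + (D₁ · u₂ + u₁) ≡ D₁ · (D₂ · i + u₂) + u₁
    lemma-i = solve-∀
    lemma-j : ∀ F₁ F₂ D₂ j i u₂ a₁ a₂ b₁ b₂ →
              F₁ · F₂ · j + (F₁ · a₂ + a₁ + b₁ · u₂) + (F₁ · b₂ + b₁ · D₂) · i
              ≡ F₁ · (F₂ · j + a₂ + b₂ · i) + a₁ + b₁ · (D₂ · i + u₂)
    lemma-j = solve-∀

  act-e : ∀ p → act e p ≡ p
  act-e (i , j) =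
    cong₂ _,_ (reduce-≋ι Fin.zero (≋-reflexive (lemma-i (ι i))))
              (reduce-≋ι Fin.zero (≋-reflexive (lemma-j (ι j) (ι i))))
    where
    lemma-i : ∀ x → + 1 · x + + 0 ≡ x
    lemma-i = solve-∀
    lemma-j : ∀ x y → + 1 · x + + 0 + + 0 · y ≡ x
    lemma-j = solve-∀

  act-inverse : ∀ g p → act (g ⁻¹) (act g p) ≡ p
  act-inverse g p =
    trans (sym (act-∙ (g ⁻¹) g p)) (trans (cong (λ h → act h p) (∙-inverseˡ g)) (act-e p))

  origin : V n m
  origin = Fin.zero , Fin.zero

  act-origin : ∀ g → act g origin ≡ (reduceₙ (u g) , reduceₘ (a g))
  act-origin g = cong₂ _,_ (reduceₙ-cong (≋-reflexive (lemma-i (sg (δ g)) (u g))))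
                           (reduceₘ-cong (≋-reflexive (lemma-j (sg (f g)) (a g) (b g))))
    where
    lemma-i : ∀ D u → D · + 0 + u ≡ u
    lemma-i = solve-∀
    lemma-j : ∀ F a b → F · + 0 + a + b · + 0 ≡ a
    lemma-j = solve-∀

  act-origin-injective : ∀ g h → act g origin ≡ act h origin →
                         (u g ≋⟨ n ⟩ u h) × (a g ≋⟨ m ⟩ a h)
  act-origin-injective g h eq =
    reduceₙ-injective (cong proj₁ eq′) , reduceₘ-injective (cong proj₂ eq′)
    where
    eq′ = trans (sym (act-origin g)) (trans eq (act-origin h))

  odd-n : odd n ≡ true
  odd-n = trans (cong odd n-odd) (cong not (odd-2* n′))

  odd-∸ : ∀ t → t ≤ n → odd (n ∸ t) ≡ not (odd t)
  odd-∸ t t≤n = lemma (odd (n ∸ t)) (odd t) (begin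
    odd (n ∸ t) xor odd t   ≡⟨ sym (odd-+ (n ∸ t) t) ⟩
    odd (n ∸ t ℕ.+ t)       ≡⟨ cong odd (ℕₚ.m∸n+n≡m t≤n) ⟩
    odd n                   ≡⟨ odd-n ⟩
    true                    ∎)
    where
    open ≡-Reasoning
    lemma : ∀ x y → x xor y ≡ true → x ≡ not y
    lemma false true  _ = refl
    lemma true  false _ = refl

  flip : Fin m → Fin m
  flip j = reduceₘ (- ι j + -1ℤ)

  ι-flip : ∀ j → ι (flip j) ≋⟨ m ⟩ - ι j + -1ℤ
  ι-flip j = ι-reduceₘ (- ι j + -1ℤ)

  flip-involutive : ∀ j → flip (flip j) ≡ j
  flip-involutive j = reduce-≋ι Fin.zero (begin
    - ι (flip j) + -1ℤ      ≈⟨ ≋-+ʳ -1ℤ (≋-neg (ι-flip j)) ⟩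
    - (- ι j + -1ℤ) + -1ℤ   ≡⟨ lemma (ι j) ⟩
    ι j                     ∎)
    where
    open ≋-Reasoning
    lemma : ∀ x → - (- x + -1ℤ) + -1ℤ ≡ x
    lemma = solve-∀

  flipIf : Bool → Fin m → Fin m
  flipIf b = if b then flip else id

  flipIf-involutive : ∀ b j → flipIf b (flipIf b j) ≡ j
  flipIf-involutive false j = refl
  flipIf-involutive true  j = flip-involutive j

  flipIf-not-flip : ∀ b j → flipIf (not b) (flip (flipIf b j)) ≡ j
  flipIf-not-flip false j = flip-involutive j
  flipIf-not-flip true  j = flip-involutive j

  ψ : V n m → V n m
  ψ (i , j) = i , flipIf (odd (toℕ i)) j

  ψ-involutive : ∀ p → ψ (ψ p) ≡ p
  ψ-involutive (i , j) = cong (i ,_) (flipIf-involutive (odd (toℕ i)) j)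

  ψ-injective : ∀ {p q} → ψ p ≡ ψ q → p ≡ q
  ψ-injective {p} {q} eq = trans (sym (ψ-involutive p)) (trans (cong ψ eq) (ψ-involutive q))

  vert : Flag → V n m
  vert x = ψ (act (elt x) origin)

  induced : Aff → V n m → V n m
  induced γ = ψ ∘ act γ ∘ ψ

  vert-[] : ∀ g → vert [ g ] ≡ ψ (reduceₙ (u g) , reduceₘ (a g))
  vert-[] g = cong ψ (trans (act-cong (elt-[] g) origin) (act-origin g))

  vert-L : ∀ γ x → vert (L γ x) ≡ induced γ (vert x)
  vert-L γ x = cong ψ (begin
    act (elt (L γ x)) origin          ≡⟨ act-cong (elt-L γ x) origin ⟩
    act (γ ∙ elt x) origin            ≡⟨ act-∙ γ (elt x) origin ⟩
    act γ (act (elt x) origin)        ≡⟨ cong (act γ) (sym (ψ-involutive _)) ⟩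
    act γ (ψ (vert x))                ∎)
    where open ≡-Reasoning

  vert-R : ∀ ρ x → vert (R ρ x) ≡ ψ (act (elt x) (act ρ origin))
  vert-R ρ x = cong ψ (trans (act-cong (elt-R ρ x) origin) (act-∙ (elt x) ρ origin))

  induced-∙ : ∀ g h p → induced (g ∙ h) p ≡ induced g (induced h p)
  induced-∙ g h p = cong ψ (trans (act-∙ g h (ψ p)) (cong (act g) (sym (ψ-involutive _))))

  induced-cong : ∀ {g h} → g ≈ h → ∀ p → induced g p ≡ induced h p
  induced-cong g≈h p = cong ψ (act-cong g≈h (ψ p))

  induced-inverseˡ : ∀ g p → induced (g ⁻¹) (induced g p) ≡ p
  induced-inverseˡ g p = begin
    ψ (act (g ⁻¹) (ψ (ψ (act g (ψ p)))))   ≡⟨ cong (ψ ∘ act (g ⁻¹)) (ψ-involutive _) ⟩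
    ψ (act (g ⁻¹) (act g (ψ p)))           ≡⟨ cong ψ (act-inverse g (ψ p)) ⟩
    ψ (ψ p)                                ≡⟨ ψ-involutive p ⟩
    p                                      ∎
    where open ≡-Reasoning

  induced-inverseʳ : ∀ g p → induced g (induced (g ⁻¹) p) ≡ p
  induced-inverseʳ g p = begin
    induced g (induced (g ⁻¹) p)           ≡⟨ sym (induced-∙ g (g ⁻¹) p) ⟩
    induced (g ∙ g ⁻¹) p                   ≡⟨ cong (λ h → induced h p) (∙-inverseʳ g) ⟩
    ψ (act e (ψ p))                        ≡⟨ cong ψ (act-e (ψ p)) ⟩
    ψ (ψ p)                                ≡⟨ ψ-involutive p ⟩
    p                                      ∎
    where open ≡-Reasoning

  act-σ₁′ : ∀ i j → act σ₁′ (i , j) ≡ (r i , flip j)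
  act-σ₁′ i j = cong₂ _,_ (reduce-cong Fin.zero i (≋-reflexive (lemma-i (ι i))))
                          (reduceₘ-cong (≋-reflexive (lemma-j (ι j) (ι i))))
    where
    lemma-i : ∀ x → + 1 · x + + 1 ≡ x + + 1
    lemma-i = solve-∀
    lemma-j : ∀ x y → -1ℤ · x + -1ℤ + + 0 · y ≡ - x + -1ℤ
    lemma-j = solve-∀

  act-σ₂′ : ∀ i j → act σ₂′ (i , j) ≡ (z i , reduceₘ (- ι j - + 2 · ι i))
  act-σ₂′ i j = cong₂ _,_ (reduce-cong Fin.zero i (≋-reflexive (lemma-i (ι i))))
                          (reduceₘ-cong (≋-reflexive (lemma-j (ι j) (ι i))))
    where
    lemma-i : ∀ x → -1ℤ · x + + 0 ≡ - x
    lemma-i = solve-∀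
    lemma-j : ∀ x y → -1ℤ · x + + 0 + -[1+ 1 ] · y ≡ - x - + 2 · y
    lemma-j = solve-∀

  flip≡cpow-1∘t : ∀ j → flip j ≡ cpow -1ℤ (t j)
  flip≡cpow-1∘t j = reduce-cong Fin.zero (t j) (≋-+ʳ -1ℤ (≋-sym (ι-reduce j (- ι j))))

  βexp-suc : ∀ k → βexp (suc k) ≡ sg (odd k) · (+ 2 · + k - + 1)
  βexp-suc k = begin
    -1ℤ ℤ.^ k · (+ (2 * suc k) - + 3)
      ≡⟨ cong₂ (λ c d → c · (d - + 3)) (-1^≡sg∘odd k) (ℤₚ.pos-* 2 (suc k)) ⟩
    sg (odd k) · (+ 2 · (+ 1 + + k) - + 3)
      ≡⟨ lemma (sg (odd k)) (+ k) ⟩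
    sg (odd k) · (+ 2 · + k - + 1)
      ∎
    where
    open ≡-Reasoning
    lemma : ∀ S K → S · (+ 2 · (+ 1 + K) - + 3) ≡ S · (+ 2 · K - + 1)
    lemma = solve-∀

  σ₁-fibre : ∀ (i : Fin n) (j : Fin m) →
             flipIf (odd (toℕ (r i))) (flip (flipIf (odd (toℕ i)) j))
             ≡ (if suc (toℕ i) ℕ.≡ᵇ n then cpow -1ℤ (t j) else j)
  σ₁-fibre i j with suc (toℕ i) ℕ.≡ᵇ n in is-last
  ... | true = trans (cong₂ (λ c d → flipIf (odd c) (flip (flipIf d j))) (toℕ-r-last i last) even)
                     (flip≡cpow-1∘t j)
    where
    last : suc (toℕ i) ≡ n
    last = ℕₚ.≡ᵇ⇒≡ _ _ (subst T (sym is-last) tt)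
    even : odd (toℕ i) ≡ false
    even = trans (cong odd (ℕₚ.suc-injective (trans last n-odd))) (odd-2* n′)
  ... | false = trans (cong (λ c → flipIf (odd c) (flip (flipIf (odd (toℕ i)) j))) (toℕ-r i not-last))
                      (flipIf-not-flip (odd (toℕ i)) j)
    where
    not-last : suc (toℕ i) ≢ n
    not-last eq = subst T is-last (ℕₚ.≡⇒≡ᵇ _ _ eq)

  induced-σ₁′ : ∀ p → induced σ₁′ p ≡ σ₁ n m p
  induced-σ₁′ (i , j) =
    trans (cong ψ (act-σ₁′ i (flipIf (odd (toℕ i)) j))) (cong (r i ,_) (σ₁-fibre i j))

  σ₂-fibre-positive : ∀ o (j : Fin m) x → flipIf (not o) (reduceₘ (- ι (flipIf o j) - + 2 · x))
                                ≡ reduce j (ι j + sg o · (+ 2 · x - + 1))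
  σ₂-fibre-positive false j x = reduce-cong Fin.zero j (begin
    - ι (reduceₘ (- ι j - + 2 · x)) + -1ℤ   ≈⟨ ≋-+ʳ -1ℤ (≋-neg (ι-reduceₘ (- ι j - + 2 · x))) ⟩
    - (- ι j - + 2 · x) + -1ℤ               ≡⟨ lemma (ι j) x ⟩
    ι j + + 1 · (+ 2 · x - + 1)             ∎)
    where
    open ≋-Reasoning
    lemma : ∀ y x → - (- y - + 2 · x) + -1ℤ ≡ y + + 1 · (+ 2 · x - + 1)
    lemma = solve-∀
  σ₂-fibre-positive true j x = reduce-cong Fin.zero j (begin
    - ι (flip j) - + 2 · x                  ≈⟨ ≋-+ʳ (- (+ 2 · x)) (≋-neg (ι-flip j)) ⟩
    - (- ι j + -1ℤ) - + 2 · x               ≡⟨ lemma (ι j) x ⟩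
    ι j + -1ℤ · (+ 2 · x - + 1)             ∎)
    where
    open ≋-Reasoning
    lemma : ∀ y x → - (- y + -1ℤ) - + 2 · x ≡ y + -1ℤ · (+ 2 · x - + 1)
    lemma = solve-∀

  σ₂-fibre : ∀ (i : Fin n) (j : Fin m) →
             flipIf (odd (toℕ (z i))) (reduceₘ (- ι (flipIf (odd (toℕ i)) j) - + 2 · ι i))
             ≡ (if toℕ i ℕ.≡ᵇ 0 then t j else cpow (βexp (suc (toℕ i))) j)
  σ₂-fibre Fin.zero j = reduce-cong Fin.zero j (≋-reflexive (lemma (ι j)))
    where
    lemma : ∀ y → - y - + 2 · + 0 ≡ - y
    lemma = solve-∀
  σ₂-fibre i@(Fin.suc i′) j = begin
    flipIf (odd (toℕ (z i))) (reduceₘ (- ι (flipIf o j) - + 2 · ι i))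
      ≡⟨ cong (λ c → flipIf c (reduceₘ (- ι (flipIf o j) - + 2 · ι i))) odd-z ⟩
    flipIf (not o) (reduceₘ (- ι (flipIf o j) - + 2 · ι i))
      ≡⟨ σ₂-fibre-positive o j (ι i) ⟩
    reduce j (ι j + sg o · (+ 2 · ι i - + 1))
      ≡⟨ cong (λ c → reduce j (ι j + c)) (sym (βexp-suc (toℕ i))) ⟩
    cpow (βexp (suc (toℕ i))) j
      ∎
    where
    open ≡-Reasoning
    o : Bool
    o = odd (toℕ i)
    odd-z : odd (toℕ (z i)) ≡ not o
    odd-z = trans (cong odd (toℕ-z i′)) (odd-∸ (toℕ i) (ℕₚ.<⇒≤ (Finₚ.toℕ<n i)))

  induced-σ₂′ : ∀ p → induced σ₂′ p ≡ σ₂ n m p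
  induced-σ₂′ (i , j) =
    trans (cong ψ (act-σ₂′ i (flipIf (odd (toℕ i)) j))) (cong (z i ,_) (σ₂-fibre i j))

  translation : ℤ → ℤ → Aff
  translation x y = mk false x false y (+ 0)

  shear : ℤ → Aff
  shear w = mk false (+ 0) false (+ 0) w

  linear : Bool → Bool → Aff
  linear d f = mk d (+ 0) f (+ 0) (+ 0)

  translation-cong : ∀ {x x′ y y′} → x ≋⟨ n ⟩ x′ → y ≋⟨ m ⟩ y′ →
                     translation x y ≈ translation x′ y′
  translation-cong x≋ y≋ = mk≈ refl x≋ refl y≋ ≋-refl

  shear-cong : ∀ {w w′} → w ≋⟨ m ⟩ w′ → shear w ≈ shear w′
  shear-cong w≋ = mk≈ refl ≋-refl refl ≋-refl w≋

  τ τ′ : Aff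
  τ  = translation (+ 1) (+ 0)
  τ′ = translation (+ 0) (+ 1)

  decomposition : ∀ g → translation (u g) (a g) ∙ (shear (b g · sg (δ g)) ∙ linear (δ g) (f g)) ≡ g
  decomposition (mk δ u f a b) =
    mk-cong refl (lemma-u u) refl (lemma-a a b (sg δ))
            (trans (lemma-b b (sg δ)) (trans (cong (_-_ b) (x-x·sg² δ b)) (ℤₚ.+-identityʳ b)))
    where
    lemma-u : ∀ u → + 1 · (+ 1 · + 0 + + 0) + u ≡ u
    lemma-u = solve-∀
    lemma-a : ∀ a b D → + 1 · (+ 1 · + 0 + + 0 + b · D · + 0) + a + + 0 · (+ 1 · + 0 + + 0) ≡ a
    lemma-a = solve-∀
    lemma-b : ∀ b D → + 1 · (+ 1 · + 0 + b · D · D) + + 0 · D ≡ b - (b - b · (D · D))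
    lemma-b = solve-∀

  translation-^ : ∀ x y c → translation x y ^ c ≡ translation (+ c · x) (+ c · y)
  translation-^ x y zero = mk-cong refl (sym (ℤₚ.*-zeroˡ x)) refl (sym (ℤₚ.*-zeroˡ y)) refl
  translation-^ x y (suc c) rewrite translation-^ x y c =
    mk-cong refl (lemma-u (+ c) x) refl (lemma-a (+ c) x y) refl
    where
    lemma-u : ∀ c x → + 1 · x + c · x ≡ (+ 1 + c) · x
    lemma-u = solve-∀
    lemma-a : ∀ c x y → + 1 · y + c · y + + 0 · x ≡ (+ 1 + c) · y
    lemma-a = solve-∀

  shear-^ : ∀ w c → shear w ^ c ≡ shear (+ c · w)
  shear-^ w zero = mk-cong refl refl refl refl (sym (ℤₚ.*-zeroˡ w))
  shear-^ w (suc c) rewrite shear-^ w c = mk-cong refl refl refl (lemma-a (+ c) w) (lemma-b (+ c) w)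
    where
    lemma-a : ∀ c w → + 1 · + 0 + + 0 + c · w · + 0 ≡ + 0
    lemma-a = solve-∀
    lemma-b : ∀ c w → + 1 · w + c · w · + 1 ≡ (+ 1 + c) · w
    lemma-b = solve-∀

  -- 2 (n′ + 1) = n + 1 ≡ 1 (mod n).
  τ≈σ₁′² : (σ₁′ ∙ σ₁′) ^ suc n′ ≈ τ
  τ≈σ₁′² = ≈-trans (≡⇒≈ (translation-^ (+ 2) (+ 0) (suc n′)))
    (mk≈ refl (+ 1 ,≋ trans (lemma (+ n′)) (cong (λ c → + 1 + + 1 · c) (sym n≡)))
         refl (≋-reflexive (ℤₚ.*-zeroʳ (+ suc n′))) ≋-refl)
    where
    n≡ : + n ≡ + 1 + + 2 · + n′
    n≡ = trans (cong +_ n-odd) (pos-odd n′)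
    lemma : ∀ p → (+ 1 + p) · + 2 ≡ + 1 + + 1 · (+ 1 + + 2 · p)
    lemma = solve-∀

  -- 4 (mj + 1)² = (m + 1)² ≡ 1 (mod m).
  shear≈σ₂′² : (σ₂′ ∙ σ₂′) ^ (suc mj * suc mj) ≈ shear (+ 1)
  shear≈σ₂′² = ≈-trans (≡⇒≈ (shear-^ (+ 4) (suc mj * suc mj)))
    (mk≈ refl ≋-refl refl ≋-refl
       (+ 3 + + 2 · + mj ,≋ trans (cong (_· + 4) (ℤₚ.pos-* (suc mj) (suc mj)))
                            (trans (lemma (+ mj)) (cong (λ c → + 1 + (+ 3 + + 2 · + mj) · c) (sym (pos-odd mj))))))
    where
    lemma : ∀ p → (+ 1 + p) · (+ 1 + p) · + 4 ≡ + 1 + (+ 3 + + 2 · p) · (+ 1 + + 2 · p)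
    lemma = solve-∀

  τ′≡ : τ′ ≡ (τ ∙ shear (+ 1) ∙ τ ⁻¹) ⁻¹ ∙ shear (+ 1)
  τ′≡ = refl

  fibre-reflection≡ : linear false true ≡ τ ⁻¹ ∙ σ₁′ ∙ τ′ ⁻¹
  fibre-reflection≡ = refl

  layer-reflection≡ : linear true false ≡ σ₂′ ∙ (shear (+ 1) ∙ shear (+ 1)) ⁻¹ ∙ linear false true
  layer-reflection≡ = refl

  record σ′-Subgroup (Q : Aff → Set) : Set where
    field
      ≈-closed  : ∀ {g h} → g ≈ h → Q g → Q h
      σ₁′∈      : Q σ₁′
      σ₂′∈      : Q σ₂′
      ∙-closed  : ∀ {g h} → Q g → Q h → Q (g ∙ h)
      ⁻¹-closed : ∀ {g} → Q g → Q (g ⁻¹)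

  module _ {Q : Aff → Set} (H : σ′-Subgroup Q) where
    open σ′-Subgroup H

    private
      e∈ : Q e
      e∈ = subst Q (∙-inverseʳ σ₁′) (∙-closed σ₁′∈ (⁻¹-closed σ₁′∈))

      ^-closed : ∀ {g} c → Q g → Q (g ^ c)
      ^-closed zero    _  = e∈
      ^-closed (suc c) g∈ = ∙-closed (^-closed c g∈) g∈

      τ∈ : Q τ
      τ∈ = ≈-closed τ≈σ₁′² (^-closed (suc n′) (∙-closed σ₁′∈ σ₁′∈))

      shear∈ : ∀ w → Q (shear (+ w))
      shear∈ w = subst Q (trans (shear-^ (+ 1) w) (cong shear (ℤₚ.*-identityʳ (+ w))))
        (^-closed w (≈-closed shear≈σ₂′² (^-closed (suc mj * suc mj) (∙-closed σ₂′∈ σ₂′∈))))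

      τ′∈ : Q τ′
      τ′∈ = subst Q (sym τ′≡)
        (∙-closed (⁻¹-closed (∙-closed (∙-closed τ∈ (shear∈ 1)) (⁻¹-closed τ∈))) (shear∈ 1))

      translation∈ : ∀ x y → Q (translation (+ x) (+ y))
      translation∈ x y = subst Q
        (trans (cong₂ _∙_ (translation-^ (+ 1) (+ 0) x) (translation-^ (+ 0) (+ 1) y))
               (mk-cong refl (lemma-u (+ x) (+ y)) refl (lemma-a (+ x) (+ y)) refl))
        (∙-closed (^-closed x τ∈) (^-closed y τ′∈))
        where
        lemma-u : ∀ x y → + 1 · (y · + 0) + x · + 1 ≡ x
        lemma-u = solve-∀
        lemma-a : ∀ x y → + 1 · (y · + 1) + x · + 0 + + 0 · (y · + 0) ≡ y
        lemma-a = solve-∀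

      fibre-reflection∈ : Q (linear false true)
      fibre-reflection∈ = subst Q (sym fibre-reflection≡)
        (∙-closed (∙-closed (⁻¹-closed τ∈) σ₁′∈) (⁻¹-closed τ′∈))

      layer-reflection∈ : Q (linear true false)
      layer-reflection∈ = subst Q (sym layer-reflection≡)
        (∙-closed (∙-closed σ₂′∈ (⁻¹-closed (∙-closed (shear∈ 1) (shear∈ 1)))) fibre-reflection∈)

      linear∈ : ∀ d f → Q (linear d f)
      linear∈ false false = e∈
      linear∈ false true  = fibre-reflection∈
      linear∈ true  false = layer-reflection∈
      linear∈ true  true  = ∙-closed layer-reflection∈ fibre-reflection∈

    σ′-generate : ∀ g → Q g
    σ′-generate g = subst Q (decomposition g) (≈-closed reduced≈ (∙-closed
      (translation∈ (toℕ (reduceₙ (u g))) (toℕ (reduceₘ (a g))))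
      (∙-closed (shear∈ (toℕ (reduceₘ (b g · sg (δ g))))) (linear∈ (δ g) (f g)))))
      where
      reduced≈ : translation (ι (reduceₙ (u g))) (ι (reduceₘ (a g)))
                 ∙ (shear (ι (reduceₘ (b g · sg (δ g)))) ∙ linear (δ g) (f g))
                 ≈ translation (u g) (a g) ∙ (shear (b g · sg (δ g)) ∙ linear (δ g) (f g))
      reduced≈ = ∙-cong (translation-cong (ι-reduceₙ (u g)) (ι-reduceₘ (a g)))
                        (∙-congʳ (linear (δ g) (f g)) (shear-cong (ι-reduceₘ (b g · sg (δ g)))))

  x₀ : Flag
  x₀ = [ e ]

  Step : Flag → Flag → Set
  Step x y = (y ≡ R₀ x) ⊎ (y ≡ R₁ x) ⊎ (y ≡ R₂ x)

  Step-sym : ∀ {x y} → Step x y → Step y x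
  Step-sym (inj₁ refl)        = inj₁ (sym (R-involutive ρ₀ refl _))
  Step-sym (inj₂ (inj₁ refl)) = inj₂ (inj₁ (sym (R-involutive ρ₁ refl _)))
  Step-sym (inj₂ (inj₂ refl)) = inj₂ (inj₂ (sym (R-involutive ρ₂ refl _)))

  Step-L : ∀ γ {x y} → Step x y → Step (L γ x) (L γ y)
  Step-L γ {x} (inj₁ refl)        = inj₁ (L-R γ ρ₀ x)
  Step-L γ {x} (inj₂ (inj₁ refl)) = inj₂ (inj₁ (L-R γ ρ₁ x))
  Step-L γ {x} (inj₂ (inj₂ refl)) = inj₂ (inj₂ (L-R γ ρ₂ x))

  L-x₀ : ∀ γ → L γ x₀ ≡ [ γ ]
  L-x₀ γ = trans (L-[] γ e) (cong [_] (∙-identityʳ γ))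

  Reachable : Aff → Set
  Reachable g = Star Step x₀ [ g ]

  reachable-subgroup : σ′-Subgroup Reachable
  reachable-subgroup = record
    { ≈-closed  = λ g≈h → subst (Star Step x₀) ([]-cong g≈h)
    ; σ₁′∈      = step-right ρ₀ (inj₁ refl) (step-right ρ₁ (inj₂ (inj₁ refl)) ε)
    ; σ₂′∈      = step-right ρ₁ (inj₂ (inj₁ refl)) (step-right ρ₂ (inj₂ (inj₂ refl)) ε)
    ; ∙-closed  = λ {g} {h} g∈ h∈ →
        g∈ ◅◅ subst₂ (Star Step) (L-x₀ g) (L-[] g h) (gmap (L g) (Step-L g) h∈)
    ; ⁻¹-closed = λ {g} g∈ → reverse Step-sym
        (subst₂ (Star Step) (L-x₀ (g ⁻¹)) (trans (L-[] (g ⁻¹) g) (cong [_] (∙-inverseˡ g)))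
                (gmap (L (g ⁻¹)) (Step-L (g ⁻¹)) g∈))
    }
    where
    step-right : ∀ {g} ρ → (∀ {x} → Step x (R ρ x)) → Reachable g → Reachable (g ∙ ρ)
    step-right {g} ρ step g∈ = g∈ ◅◅ return (subst (Step [ g ]) (R-[] ρ g) step)

  reach : ∀ x → Star Step x₀ x
  reach x = subst (Star Step x₀) ([]-elt x) (σ′-generate reachable-subgroup (elt x))

  M : FlagMap
  M = record
    { N = N ; r₀ = R₀ ; r₁ = R₁ ; r₂ = R₂
    ; r₀-inv = R-involutive ρ₀ refl ; r₁-inv = R-involutive ρ₁ refl ; r₂-inv = R-involutive ρ₂ refl
    ; r₀-fpf = R-fixed-point-free-δ ρ₀ refl
    ; r₁-fpf = R-fixed-point-free-δ ρ₁ refl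
    ; r₂-fpf = R-fixed-point-free-f ρ₂ refl
    ; r₀r₂-comm = R₀R₂-comm ; r₀r₂-fpf = R₀R₂-fixed-point-free
    ; connected = λ a b → reverse Step-sym (reach a) ◅◅ reach b }

  isAut-L : ∀ γ → IsAut M (L γ)
  isAut-L γ = (L (γ ⁻¹) , L-inverseˡ γ , L-inverseʳ γ) , L-R γ ρ₀ , L-R γ ρ₁ , L-R γ ρ₂

  elt-iter-RR : ∀ ρ ρ′ k x → elt (iter (R ρ′ ∘ R ρ) k x) ≈ elt x ∙ (ρ ∙ ρ′) ^ k
  elt-iter-RR ρ ρ′ zero x = ≡⇒≈ (sym (∙-identityʳ (elt x)))
  elt-iter-RR ρ ρ′ (suc k) x = begin
    elt (R ρ′ (R ρ (iter (R ρ′ ∘ R ρ) k x)))   ≈⟨ elt-RR ρ ρ′ _ ⟩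
    elt (iter (R ρ′ ∘ R ρ) k x) ∙ (ρ ∙ ρ′)     ≈⟨ ∙-congʳ (ρ ∙ ρ′) (elt-iter-RR ρ ρ′ k x) ⟩
    elt x ∙ (ρ ∙ ρ′) ^ k ∙ (ρ ∙ ρ′)            ≡⟨ ∙-assoc (elt x) ((ρ ∙ ρ′) ^ k) (ρ ∙ ρ′) ⟩
    elt x ∙ (ρ ∙ ρ′) ^ suc k                   ∎
    where open ≈-Reasoning

  face-fibre : Bool → ℤ
  face-fibre false = + 0
  face-fibre true  = -1ℤ

  face-rotation-^ : ∀ i → (ρ₀ ∙ ρ₁) ^ i ≡ mk false (- + i) (odd i) (face-fibre (odd i)) (+ 0)
  face-rotation-^ zero    = refl
  face-rotation-^ (suc i) = trans (cong (_∙ (ρ₀ ∙ ρ₁)) (face-rotation-^ i)) (step (odd i))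
    where
    lemma : ∀ x → + 1 · -1ℤ + - x ≡ - (+ 1 + x)
    lemma = solve-∀
    step : ∀ o → mk false (- + i) o (face-fibre o) (+ 0) ∙ (ρ₀ ∙ ρ₁)
                 ≡ mk false (- + suc i) (not o) (face-fibre (not o)) (+ 0)
    step false = mk-cong refl (lemma (+ i)) refl refl refl
    step true  = mk-cong refl (lemma (+ i)) refl refl refl

  vertex-rotation-^ : ∀ i → (ρ₁ ∙ ρ₂) ^ i ≡ mk (odd i) (+ 0) (odd i) (+ 0) (- (sg (odd i) · (+ 2 · + i)))
  vertex-rotation-^ zero    = refl
  vertex-rotation-^ (suc i) = trans (cong (_∙ (ρ₁ ∙ ρ₂)) (vertex-rotation-^ i)) (step (odd i))
    where
    lemma-a : ∀ x → + 0 + + 0 + x · + 0 ≡ + 0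
    lemma-a = solve-∀
    lemma-b : ∀ S x → S · + 2 + - (S · (+ 2 · x)) · -1ℤ ≡ - (- S · (+ 2 · (+ 1 + x)))
    lemma-b = solve-∀
    step : ∀ o → mk o (+ 0) o (+ 0) (- (sg o · (+ 2 · + i))) ∙ (ρ₁ ∙ ρ₂)
                 ≡ mk (not o) (+ 0) (not o) (+ 0) (- (sg (not o) · (+ 2 · + suc i)))
    step false = mk-cong refl refl refl (lemma-a (- (+ 1 · (+ 2 · + i)))) (lemma-b (+ 1) (+ i))
    step true  = mk-cong refl refl refl (lemma-a (- (-1ℤ · (+ 2 · + i)))) (lemma-b -1ℤ (+ i))

  HasOrder : Aff → ℕ → Set
  HasOrder g k = 0 < k × g ^ k ≈ e × (∀ i → 0 < i → i < k → ¬ (g ^ i ≈ e))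

  face-rotation-order : HasOrder (ρ₀ ∙ ρ₁) (2 * n)
  face-rotation-order = s≤s z≤n , subst (_≈ e) (sym (face-rotation-^ (2 * n))) full , proper
    where
    lemma : ∀ x → - (+ 2 · x) ≡ + 0 + -[1+ 1 ] · x
    lemma = solve-∀
    full : mk false (- + (2 * n)) (odd (2 * n)) (face-fibre (odd (2 * n))) (+ 0) ≈ e
    full rewrite odd-2* n =
      mk≈ refl (-[1+ 1 ] ,≋ trans (cong -_ (ℤₚ.pos-* 2 n)) (lemma (+ n))) refl ≋-refl ≋-refl
    proper : ∀ i → 0 < i → i < 2 * n → ¬ ((ρ₀ ∙ ρ₁) ^ i ≈ e)
    proper i 0<i i<2n X^i≈e = ℕₚ.<⇒≢ 0<i (sym (≋-same-parity⇒≡ n′ n-odd i<2n (s≤s z≤n)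
      (f-eq X^i≈e′) (≋-trans (≋-reflexive (sym (ℤₚ.neg-involutive (+ i)))) (≋-neg (u-eq X^i≈e′)))))
      where
      X^i≈e′ : mk false (- + i) (odd i) (face-fibre (odd i)) (+ 0) ≈ e
      X^i≈e′ = ≈-trans (≡⇒≈ (sym (face-rotation-^ i))) X^i≈e

  vertex-rotation-order : HasOrder (ρ₁ ∙ ρ₂) (2 * m)
  vertex-rotation-order = s≤s z≤n , subst (_≈ e) (sym (vertex-rotation-^ (2 * m))) full , proper
    where
    lemma : ∀ x → - (+ 1 · (+ 2 · (+ 2 · x))) ≡ + 0 + -[1+ 3 ] · x
    lemma = solve-∀
    full : mk (odd (2 * m)) (+ 0) (odd (2 * m)) (+ 0) (- (sg (odd (2 * m)) · (+ 2 · + (2 * m)))) ≈ e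
    full rewrite odd-2* m =
      mk≈ refl ≋-refl refl ≋-refl
          (-[1+ 3 ] ,≋ trans (cong (λ c → - (+ 1 · (+ 2 · c))) (ℤₚ.pos-* 2 m)) (lemma (+ m)))
    proper : ∀ i → 0 < i → i < 2 * m → ¬ ((ρ₁ ∙ ρ₂) ^ i ≈ e)
    proper i 0<i i<2m Y^i≈e = ℕₚ.<⇒≢ 0<i (sym (≋-same-parity⇒≡ mj refl i<2m (s≤s z≤n) even
      (≋-halve mj refl (≋-trans (≋-reflexive (lemma′ (+ i))) (≋-neg b≋0)))))
      where
      Y^i≈e′ : mk (odd i) (+ 0) (odd i) (+ 0) (- (sg (odd i) · (+ 2 · + i))) ≈ e
      Y^i≈e′ = ≈-trans (≡⇒≈ (sym (vertex-rotation-^ i))) Y^i≈e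
      even : odd i ≡ false
      even = δ-eq Y^i≈e′
      b≋0 : - (+ 1 · (+ 2 · + i)) ≋⟨ m ⟩ + 0
      b≋0 = subst (λ o → - (sg o · (+ 2 · + i)) ≋⟨ m ⟩ + 0) even (b-eq Y^i≈e′)
      lemma′ : ∀ x → + 2 · x ≡ - - (+ 1 · (+ 2 · x))
      lemma′ = solve-∀

  rotation-order : ∀ ρ ρ′ {k} → HasOrder (ρ ∙ ρ′) k → ∀ x → OrderAt M (R ρ′ ∘ R ρ) x k
  rotation-order ρ ρ′ {k} (0<k , ρρ′^k≈e , proper) x = 0<k , returns , λ i 0<i i<k eq →
    proper i 0<i i<k (∙-cancelˡ (elt x) (begin
      elt x ∙ (ρ ∙ ρ′) ^ i            ≈⟨ elt-iter-RR ρ ρ′ i x ⟨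
      elt (iter (R ρ′ ∘ R ρ) i x)     ≡⟨ cong elt eq ⟩
      elt x                           ≡⟨ ∙-identityʳ (elt x) ⟨
      elt x ∙ e                       ∎))
    where
    open ≈-Reasoning
    returns : iter (R ρ′ ∘ R ρ) k x ≡ x
    returns = elt-injective (begin
      elt (iter (R ρ′ ∘ R ρ) k x)     ≈⟨ elt-iter-RR ρ ρ′ k x ⟩
      elt x ∙ (ρ ∙ ρ′) ^ k            ≈⟨ ∙-congˡ (elt x) ρρ′^k≈e ⟩
      elt x ∙ e                       ≡⟨ ∙-identityʳ (elt x) ⟩
      elt x                           ∎)

  hasType : HasType M (2 * n) (2 * m)
  hasType x = rotation-order ρ₀ ρ₁ face-rotation-order x , rotation-order ρ₁ ρ₂ vertex-rotation-order x

  odd-m : odd m ≡ true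
  odd-m = cong not (odd-2* mj)

  twist : Flag → Flag
  twist x = R₁ (iter (vertRot M) m (iter (faceRot M) n x))

  twist-elt : Aff
  twist-elt = (ρ₀ ∙ ρ₁) ^ n ∙ (ρ₁ ∙ ρ₂) ^ m ∙ ρ₁

  twist-elt≈ : twist-elt ≈ translation (+ 0) -1ℤ
  twist-elt≈ = ∙-congʳ ρ₁ (∙-cong X^n≈ Y^m≈)
    where
    X^n≈ : (ρ₀ ∙ ρ₁) ^ n ≈ mk false (+ 0) true -1ℤ (+ 0)
    X^n≈ rewrite face-rotation-^ n | odd-n = mk≈ refl (≋-sym (+ 1 ,≋ lemma (+ n))) refl ≋-refl ≋-refl
      where
      lemma : ∀ x → + 0 ≡ - x + + 1 · x
      lemma = solve-∀
    Y^m≈ : (ρ₁ ∙ ρ₂) ^ m ≈ mk true (+ 0) true (+ 0) (+ 0)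
    Y^m≈ rewrite vertex-rotation-^ m | odd-m = mk≈ refl ≋-refl refl ≋-refl (+ 2 ,≋ lemma (+ m))
      where
      lemma : ∀ x → - (-1ℤ · (+ 2 · x)) ≡ + 0 + + 2 · x
      lemma = solve-∀

  elt-twist : ∀ x → elt (twist x) ≈ elt x ∙ twist-elt
  elt-twist x = begin
    elt (twist x)
      ≈⟨ elt-R ρ₁ _ ⟩
    elt (iter (vertRot M) m (iter (faceRot M) n x)) ∙ ρ₁
      ≈⟨ ∙-congʳ ρ₁ (elt-iter-RR ρ₁ ρ₂ m _) ⟩
    elt (iter (faceRot M) n x) ∙ (ρ₁ ∙ ρ₂) ^ m ∙ ρ₁
      ≈⟨ ∙-congʳ ρ₁ (∙-congʳ ((ρ₁ ∙ ρ₂) ^ m) (elt-iter-RR ρ₀ ρ₁ n x)) ⟩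
    elt x ∙ (ρ₀ ∙ ρ₁) ^ n ∙ (ρ₁ ∙ ρ₂) ^ m ∙ ρ₁
      ≡⟨ cong (_∙ ρ₁) (∙-assoc (elt x) ((ρ₀ ∙ ρ₁) ^ n) ((ρ₁ ∙ ρ₂) ^ m)) ⟩
    elt x ∙ ((ρ₀ ∙ ρ₁) ^ n ∙ (ρ₁ ∙ ρ₂) ^ m) ∙ ρ₁
      ≡⟨ ∙-assoc (elt x) ((ρ₀ ∙ ρ₁) ^ n ∙ (ρ₁ ∙ ρ₂) ^ m) ρ₁ ⟩
    elt x ∙ twist-elt
      ∎
    where open ≈-Reasoning

  elt-iter-twist : ∀ k x → elt (iter twist k x) ≈ elt x ∙ twist-elt ^ k
  elt-iter-twist zero    x = ≡⇒≈ (sym (∙-identityʳ (elt x)))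
  elt-iter-twist (suc k) x = begin
    elt (twist (iter twist k x))        ≈⟨ elt-twist (iter twist k x) ⟩
    elt (iter twist k x) ∙ twist-elt    ≈⟨ ∙-congʳ twist-elt (elt-iter-twist k x) ⟩
    elt x ∙ twist-elt ^ k ∙ twist-elt   ≡⟨ ∙-assoc (elt x) (twist-elt ^ k) twist-elt ⟩
    elt x ∙ twist-elt ^ suc k           ∎
    where open ≈-Reasoning

  twist-order : ∀ x → iter twist m x ≡ x
  twist-order x = elt-injective (begin
    elt (iter twist m x)                   ≈⟨ elt-iter-twist m x ⟩
    elt x ∙ twist-elt ^ m                  ≈⟨ ∙-congˡ (elt x) (^-cong m twist-elt≈) ⟩
    elt x ∙ translation (+ 0) -1ℤ ^ m      ≡⟨ cong (elt x ∙_) (translation-^ (+ 0) -1ℤ m) ⟩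
    elt x ∙ translation (+ m · + 0) (+ m · -1ℤ)
      ≈⟨ ∙-congˡ (elt x) (translation-cong (≋-reflexive (ℤₚ.*-zeroʳ (+ m))) (-1ℤ ,≋ lemma (+ m))) ⟩
    elt x ∙ e                              ≡⟨ ∙-identityʳ (elt x) ⟩
    elt x                                  ∎)
    where
    open ≈-Reasoning
    lemma : ∀ x → x · -1ℤ ≡ + 0 + -1ℤ · x
    lemma = solve-∀

  nonOrientable : NonOrientable M
  nonOrientable (col , flips) = Boolₚ.not-¬ refl (begin
    col x₀                        ≡⟨ cong col (twist-order x₀) ⟨
    col (iter twist m x₀)         ≡⟨ col-iter-twist m x₀ ⟩
    odd m xor col x₀              ≡⟨ cong (_xor col x₀) odd-m ⟩
    not (col x₀)                  ∎)
    where
    open ≡-Reasoning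
    iter-preserves : ∀ (g : Flag → Flag) → (∀ y → col (g y) ≡ col y) → ∀ k y → col (iter g k y) ≡ col y
    iter-preserves g pres zero    y = refl
    iter-preserves g pres (suc k) y = trans (pres _) (iter-preserves g pres k y)
    faceRot-preserves : ∀ y → col (faceRot M y) ≡ col y
    faceRot-preserves y = trans (proj₁ (proj₂ (flips (R₀ y))))
                                (trans (cong not (proj₁ (flips y))) (Boolₚ.not-involutive _))
    vertRot-preserves : ∀ y → col (vertRot M y) ≡ col y
    vertRot-preserves y = trans (proj₂ (proj₂ (flips (R₁ y))))
                                (trans (cong not (proj₁ (proj₂ (flips y)))) (Boolₚ.not-involutive _))
    twist-flips : ∀ y → col (twist y) ≡ not (col y)
    twist-flips y = trans (proj₁ (proj₂ (flips _)))
      (cong not (trans (iter-preserves _ vertRot-preserves m _) (iter-preserves _ faceRot-preserves n y)))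
    col-iter-twist : ∀ k y → col (iter twist k y) ≡ odd k xor col y
    col-iter-twist zero    y = refl
    col-iter-twist (suc k) y = trans (twist-flips _)
      (trans (cong not (col-iter-twist k y)) (Boolₚ.not-distribˡ-xor (odd k) (col y)))

  L-conjugate : ∀ ρ ρ′ x → L (elt x ∙ (ρ ∙ ρ′) ∙ elt x ⁻¹) x ≡ R ρ′ (R ρ x)
  L-conjugate ρ ρ′ x = elt-injective (begin
    elt (L (g ∙ w ∙ g ⁻¹) x)   ≈⟨ elt-L (g ∙ w ∙ g ⁻¹) x ⟩
    g ∙ w ∙ g ⁻¹ ∙ g           ≡⟨ ∙-assoc (g ∙ w) (g ⁻¹) g ⟩
    g ∙ w ∙ (g ⁻¹ ∙ g)         ≡⟨ cong (g ∙ w ∙_) (∙-inverseˡ g) ⟩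
    g ∙ w ∙ e                  ≡⟨ ∙-identityʳ (g ∙ w) ⟩
    g ∙ w                      ≈⟨ elt-RR ρ ρ′ x ⟨
    elt (R ρ′ (R ρ x))         ∎)
    where
    open ≈-Reasoning
    g w : Aff
    g = elt x
    w = ρ ∙ ρ′

  rotation-aut : ∀ ρ ρ′ x → Σ (Flag → Flag) λ g → IsAut M g × g x ≡ R ρ′ (R ρ x)
  rotation-aut ρ ρ′ x = L (elt x ∙ (ρ ∙ ρ′) ∙ elt x ⁻¹) , isAut-L _ , L-conjugate ρ ρ′ x

  reflexible : Reflexible M
  reflexible = rotary M hasType (rotation-aut ρ₁ ρ₂) (rotation-aut ρ₀ ρ₁) ,
               L ρ₀ , isAut-L ρ₀ , x₀ , 0 , trans (L-x₀ ρ₀) (sym (R-[] ρ₀ e))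

  distinguished : Distinguished M x₀ (L σ₁′) (L σ₂′)
  distinguished = isAut-L σ₁′ , isAut-L σ₂′ ,
    trans (L-x₀ σ₁′) (sym (trans (cong R₀ (R-[] ρ₁ e)) (R-[] ρ₀ (e ∙ ρ₁)))) ,
    trans (L-x₀ σ₂′) (sym (trans (cong R₁ (R-[] ρ₂ e)) (R-[] ρ₁ (e ∙ ρ₂)))) ,
    trans (cong (L σ₂′) (L-x₀ σ₁′))
          (trans (L-[] σ₂′ σ₁′) (sym (trans (cong R₀ (R-[] ρ₂ e)) (R-[] ρ₀ (e ∙ ρ₂)))))

  act-injective : ∀ g {p q} → act g p ≡ act g q → p ≡ q
  act-injective g {p} {q} eq = trans (sym (act-inverse g p)) (trans (cong (act (g ⁻¹)) eq) (act-inverse g q))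

  fixes-origin : ∀ g → act g origin ≡ origin → (u g ≋⟨ n ⟩ + 0) × (a g ≋⟨ m ⟩ + 0)
  fixes-origin g fixed = act-origin-injective g e (trans fixed (sym (act-e origin)))

  moved-by : ∀ x y {g} → elt x ⁻¹ ∙ elt y ≈ g → y ≡ [ elt x ∙ g ]
  moved-by x y {g} w≈g = begin
    y                                ≡⟨ []-elt y ⟨
    [ elt y ]                        ≡⟨ cong [_] (∙-identityˡ (elt y)) ⟨
    [ e ∙ elt y ]                    ≡⟨ cong (λ h → [ h ∙ elt y ]) (∙-inverseʳ (elt x)) ⟨
    [ elt x ∙ elt x ⁻¹ ∙ elt y ]     ≡⟨ cong [_] (∙-assoc (elt x) (elt x ⁻¹) (elt y)) ⟩
    [ elt x ∙ (elt x ⁻¹ ∙ elt y) ]   ≡⟨ []-cong (∙-congˡ (elt x) w≈g) ⟩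
    [ elt x ∙ g ]                    ∎
    where open ≡-Reasoning

  relative-fixes : ∀ x y p → act (elt x) p ≡ act (elt y) p → act (elt x ⁻¹ ∙ elt y) p ≡ p
  relative-fixes x y p eq = begin
    act (elt x ⁻¹ ∙ elt y) p           ≡⟨ act-∙ (elt x ⁻¹) (elt y) p ⟩
    act (elt x ⁻¹) (act (elt y) p)     ≡⟨ cong (act (elt x ⁻¹)) eq ⟨
    act (elt x ⁻¹) (act (elt x) p)     ≡⟨ act-inverse (elt x) p ⟩
    p                                  ∎
    where open ≡-Reasoning

  vert-R-fixed : ∀ ρ → act ρ origin ≡ origin → ∀ x → vert (R ρ x) ≡ vert x
  vert-R-fixed ρ fixed x = trans (vert-R ρ x) (cong (ψ ∘ act (elt x)) fixed)

  same-vert : ∀ a b → SameVertex M a b → vert a ≡ vert b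
  same-vert a b path = Star-respects (λ y → vert a ≡ vert y) step path refl
    where
    step : ∀ {x y} → (y ≡ R₁ x) ⊎ (y ≡ R₂ x) → vert a ≡ vert x → vert a ≡ vert y
    step (inj₁ refl) eq = trans eq (sym (vert-R-fixed ρ₁ refl _))
    step (inj₂ refl) eq = trans eq (sym (vert-R-fixed ρ₂ refl _))

  StaysAtVertex : Aff → Set
  StaysAtVertex g = ∀ x → SameVertex M x [ elt x ∙ g ]

  stays-≈ : ∀ {g h} → g ≈ h → StaysAtVertex g → StaysAtVertex h
  stays-≈ {g} {h} g≈h stays x = subst (SameVertex M x) ([]-cong (∙-congˡ (elt x) g≈h)) (stays x)

  stays-∙ : ∀ {g h} → StaysAtVertex g → StaysAtVertex h → StaysAtVertex (g ∙ h)
  stays-∙ {g} {h} g-stays h-stays x = g-stays x ◅◅ subst (SameVertex M _) [xg]h≡[x∙gh] (h-stays [ elt x ∙ g ])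
    where
    [xg]h≡[x∙gh] : [ elt [ elt x ∙ g ] ∙ h ] ≡ [ elt x ∙ (g ∙ h) ]
    [xg]h≡[x∙gh] = trans ([]-cong (∙-congʳ h (elt-[] (elt x ∙ g)))) (cong [_] (∙-assoc (elt x) g h))

  stays-e : StaysAtVertex e
  stays-e x = subst (SameVertex M x) (elt≈⇒≡[] (≡⇒≈ (sym (∙-identityʳ (elt x))))) ε

  stays-R : ∀ ρ → (∀ {x} → SameVertex M x (R ρ x)) → StaysAtVertex ρ
  stays-R ρ step x = subst (SameVertex M x) (elt≈⇒≡[] (elt-R ρ x)) step

  stays-^ : ∀ {g} k → StaysAtVertex g → StaysAtVertex (g ^ k)
  stays-^ zero    _       = stays-e
  stays-^ (suc k) g-stays = stays-∙ (stays-^ k g-stays) g-stays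

  stays-ρ₁ : StaysAtVertex ρ₁
  stays-ρ₁ = stays-R ρ₁ (return (inj₁ refl))

  stays-ρ₂ : StaysAtVertex ρ₂
  stays-ρ₂ = stays-R ρ₂ (return (inj₂ refl))

  stays-shear : ∀ w → StaysAtVertex (shear w)
  stays-shear w = stays-≈ (shear-cong (ι-reduceₘ w)) (stays-≈ shear^≈ (stays-^ W stays-shear₁))
    where
    W : ℕ
    W = toℕ (reduceₘ w)
    stays-shear₁ : StaysAtVertex (shear (+ 1))
    stays-shear₁ = stays-≈ shear≈σ₂′²
      (stays-^ (suc mj * suc mj) (stays-∙ (stays-∙ (stays-∙ stays-ρ₂ stays-ρ₁) stays-ρ₂) stays-ρ₁))
    shear^≈ : shear (+ 1) ^ W ≈ shear (+ W)
    shear^≈ = ≡⇒≈ (trans (shear-^ (+ 1) W) (cong shear (ℤₚ.*-identityʳ (+ W))))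

  stays-layer-preserving : ∀ f w → StaysAtVertex (mk false (+ 0) f (+ 0) w)
  stays-layer-preserving false w = stays-shear w
  stays-layer-preserving true  w =
    stays-≈ (mk≈ refl ≋-refl refl (≋-reflexive (lemma-a (w - + 2))) (≋-reflexive (lemma-b w)))
            (stays-∙ (stays-shear (w - + 2)) stays-ρ₂)
    where
    lemma-a : ∀ w → + 1 · + 0 + + 0 + w · + 0 ≡ + 0
    lemma-a = solve-∀
    lemma-b : ∀ w → + 1 · + 2 + (w - + 2) · + 1 ≡ w
    lemma-b = solve-∀
  stays-vertex-stabiliser : ∀ d f w → StaysAtVertex (mk d (+ 0) f (+ 0) w)
  stays-vertex-stabiliser false f w = stays-layer-preserving f w
  stays-vertex-stabiliser true  f w =
    stays-≈ (mk≈ refl ≋-refl (Boolₚ.xor-identityʳ f) (≋-reflexive (lemma-a (sg f) (- w)))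
                                                      (≋-reflexive (lemma-b (sg f) w)))
            (stays-∙ (stays-layer-preserving f (- w)) stays-ρ₁)
    where
    lemma-a : ∀ F w → F · + 0 + + 0 + w · + 0 ≡ + 0
    lemma-a = solve-∀
    lemma-b : ∀ F w → F · + 0 + - w · -1ℤ ≡ w
    lemma-b = solve-∀

  vert-same : ∀ x y → vert x ≡ vert y → SameVertex M x y
  vert-same x y eq = subst (SameVertex M x) (sym (moved-by x y (≈-sym w′≈w)))
                           (stays-vertex-stabiliser (δ w) (f w) (b w) x)
    where
    w : Aff
    w = elt x ⁻¹ ∙ elt y
    w-fixes : (u w ≋⟨ n ⟩ + 0) × (a w ≋⟨ m ⟩ + 0)
    w-fixes = fixes-origin w (relative-fixes x y origin (ψ-injective eq))
    w′≈w : mk (δ w) (+ 0) (f w) (+ 0) (b w) ≈ w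
    w′≈w = mk≈ refl (≋-sym (proj₁ w-fixes)) refl (≋-sym (proj₂ w-fixes)) ≋-refl

  vert-[]-at : ∀ g i j → u g ≋⟨ n ⟩ ι i → a g ≋⟨ m ⟩ ι (flipIf (odd (toℕ i)) j) → vert [ g ] ≡ (i , j)
  vert-[]-at g i j u≋ a≋ = trans (vert-[] g)
    (trans (cong ψ (cong₂ _,_ (reduce-≋ι Fin.zero u≋) (reduce-≋ι Fin.zero a≋))) (ψ-involutive (i , j)))

  vert-surj : ∀ p → ∃ λ x → vert x ≡ p
  vert-surj (i , j) = [ g ] , vert-[]-at g i j ≋-refl ≋-refl
    where
    g : Aff
    g = mk false (ι i) false (ι (flipIf (odd (toℕ i)) j)) (+ 0)

  layer-≋ : ∀ x → ι (proj₁ (vert x)) ≋⟨ n ⟩ u (elt x)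
  layer-≋ x = ≋-trans (ι-reduceₙ _) (≋-reflexive (lemma (sg (δ (elt x))) (u (elt x))))
    where
    lemma : ∀ D u → D · + 0 + u ≡ u
    lemma = solve-∀

  edge-adj : ∀ x → Adj n m (vert x) (vert (R₀ x))
  edge-adj x = adjacent (δ (elt x)) (layer-≋ x) (≋-trans (layer-≋ (R₀ x)) (u-eq (elt-R ρ₀ x)))
    where
    adjacent : ∀ d {i₁ i₂ : Fin n} {U} → ι i₁ ≋⟨ n ⟩ U → ι i₂ ≋⟨ n ⟩ sg d · -1ℤ + U →
               (i₁ ≡ reduce i₂ (ι i₂ + + 1)) ⊎ (i₁ ≡ reduce i₂ (ι i₂ - + 1))
    adjacent false {i₁} {i₂} {U} i₁≋ i₂≋ = inj₁ (sym (reduce-≋ι i₂ (begin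
      ι i₂ + + 1                ≈⟨ ≋-+ʳ (+ 1) i₂≋ ⟩
      + 1 · -1ℤ + U + + 1       ≡⟨ lemma U ⟩
      U                         ≈⟨ i₁≋ ⟨
      ι i₁                      ∎)))
      where
      open ≋-Reasoning
      lemma : ∀ U → + 1 · -1ℤ + U + + 1 ≡ U
      lemma = solve-∀
    adjacent true {i₁} {i₂} {U} i₁≋ i₂≋ = inj₂ (sym (reduce-≋ι i₂ (begin
      ι i₂ - + 1                ≈⟨ ≋-+ʳ (- + 1) i₂≋ ⟩
      -1ℤ · -1ℤ + U - + 1       ≡⟨ lemma U ⟩
      U                         ≈⟨ i₁≋ ⟨
      ι i₁                      ∎)))
      where
      open ≋-Reasoning
      lemma : ∀ U → -1ℤ · -1ℤ + U - + 1 ≡ U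
      lemma = solve-∀

  edge-from : ∀ d i₁ j₁ i₂ j₂ → sg d · -1ℤ + ι i₁ ≋⟨ n ⟩ ι i₂ →
              ∃ λ x → vert x ≡ (i₁ , j₁) × vert (R₀ x) ≡ (i₂ , j₂)
  edge-from d i₁ j₁ i₂ j₂ i₂≋ =
    [ g ] , vert-[]-at g i₁ j₁ ≋-refl ≋-refl ,
    trans (cong vert (R-[] ρ₀ g)) (vert-[]-at (g ∙ ρ₀) i₂ j₂ i₂≋ (≋-reflexive (lemma (ι z₁) (ι z₂))))
    where
    z₁ : Fin m
    z₁ = flipIf (odd (toℕ i₁)) j₁
    z₂ : Fin m
    z₂ = flipIf (odd (toℕ i₂)) j₂
    g : Aff
    g = mk d (ι i₁) false (ι z₁) (ι z₁ + -1ℤ + - ι z₂)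
    lemma : ∀ z₁ z₂ → + 1 · -1ℤ + z₁ + (z₁ + -1ℤ + - z₂) · -1ℤ ≡ z₂
    lemma = solve-∀

  edge-surj : ∀ p q → Adj n m p q → ∃ λ x → vert x ≡ p × vert (R₀ x) ≡ q
  edge-surj (i₁ , j₁) (i₂ , j₂) (inj₁ refl) = edge-from false _ j₁ i₂ j₂ (begin
    + 1 · -1ℤ + ι (reduce i₂ (ι i₂ + + 1))   ≈⟨ ≋-+ˡ (+ 1 · -1ℤ) (ι-reduce i₂ (ι i₂ + + 1)) ⟩
    + 1 · -1ℤ + (ι i₂ + + 1)                 ≡⟨ lemma (ι i₂) ⟩
    ι i₂                                     ∎)
    where
    open ≋-Reasoning
    lemma : ∀ x → + 1 · -1ℤ + (x + + 1) ≡ x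
    lemma = solve-∀
  edge-surj (i₁ , j₁) (i₂ , j₂) (inj₂ refl) = edge-from true _ j₁ i₂ j₂ (begin
    -1ℤ · -1ℤ + ι (reduce i₂ (ι i₂ - + 1))   ≈⟨ ≋-+ˡ (-1ℤ · -1ℤ) (ι-reduce i₂ (ι i₂ - + 1)) ⟩
    -1ℤ · -1ℤ + (ι i₂ - + 1)                 ≡⟨ lemma (ι i₂) ⟩
    ι i₂                                     ∎)
    where
    open ≋-Reasoning
    lemma : ∀ x → -1ℤ · -1ℤ + (x - + 1) ≡ x
    lemma = solve-∀

  module _ (3≤m : 3 ≤ m) where

    2<n : 2 < n
    2<n = ℕₚ.<-≤-trans 3≤m (ℕₚ.m≤n*m m s)

    2≋̸0 : ∀ {K} → 2 < K → ¬ (+ 2 ≋⟨ K ⟩ + 0)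
    2≋̸0 2<K eq with ≋⇒≡ 2 0 2<K (ℕₚ.<-trans (s≤s z≤n) 2<K) eq
    ... | ()

    0≋̸-1 : ¬ (+ 0 ≋⟨ m ⟩ -1ℤ)
    0≋̸-1 eq with ≋⇒≡ 0 1 (ℕₚ.<-trans (s≤s z≤n) 3≤m) (ℕₚ.<-trans (s≤s (s≤s z≤n)) 3≤m) (≋-neg eq)
    ... | ()

    sg·2≋̸0 : ∀ d → ¬ (sg d · + 2 ≋⟨ m ⟩ + 0)
    sg·2≋̸0 false eq = 2≋̸0 3≤m eq
    sg·2≋̸0 true  eq = 2≋̸0 3≤m (≋-neg eq)


    edge-stabiliser-normal : ∀ d f B → sg d · -1ℤ + + 0 ≋⟨ n ⟩ -1ℤ →
                             sg f · -1ℤ + + 0 + B · -1ℤ ≋⟨ m ⟩ -1ℤ →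
                             (mk d (+ 0) f (+ 0) B ≈ e) ⊎ (mk d (+ 0) f (+ 0) B ≈ ρ₂)
    edge-stabiliser-normal true  _     _ u≋ _  = ⊥-elim (2≋̸0 2<n (≋-+ʳ (+ 1) u≋))
    edge-stabiliser-normal false false B _  a≋ =
      inj₁ (mk≈ refl ≋-refl refl ≋-refl (≋-trans (≋-reflexive (lemma B)) (≋-neg (≋-+ʳ (+ 1) a≋))))
      where
      lemma : ∀ B → B ≡ - (+ 1 · -1ℤ + + 0 + B · -1ℤ + + 1)
      lemma = solve-∀
    edge-stabiliser-normal false true  B _  a≋ =
      inj₂ (mk≈ refl ≋-refl refl ≋-refl (≋-trans (≋-reflexive (lemma B)) (≋-+ˡ (+ 1) (≋-neg a≋))))
      where
      lemma : ∀ B → B ≡ + 1 + - (-1ℤ · -1ℤ + + 0 + B · -1ℤ)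
      lemma = solve-∀

    edge-stabiliser : ∀ w → act w origin ≡ origin → act (w ∙ ρ₀) origin ≡ act ρ₀ origin →
                      (w ≈ e) ⊎ (w ≈ ρ₂)
    edge-stabiliser w fixes-0 fixes-1 =
      Sum.map (≈-trans w≈w′) (≈-trans w≈w′) (edge-stabiliser-normal (δ w) (f w) (b w) u≋ a≋)
      where
      w′ : Aff
      w′ = mk (δ w) (+ 0) (f w) (+ 0) (b w)
      w≈w′ : w ≈ w′
      w≈w′ = mk≈ refl (proj₁ (fixes-origin w fixes-0)) refl (proj₂ (fixes-origin w fixes-0)) ≋-refl
      u≋ : sg (δ w) · -1ℤ + + 0 ≋⟨ n ⟩ -1ℤ
      u≋ = proj₁ (act-origin-injective (w′ ∙ ρ₀) ρ₀
                   (trans (act-cong (∙-congʳ ρ₀ (≈-sym w≈w′)) origin) fixes-1))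
      a≋ : sg (f w) · -1ℤ + + 0 + b w · -1ℤ ≋⟨ m ⟩ -1ℤ
      a≋ = proj₂ (act-origin-injective (w′ ∙ ρ₀) ρ₀
                   (trans (act-cong (∙-congʳ ρ₀ (≈-sym w≈w′)) origin) fixes-1))

    edge-inj : ∀ x y → vert x ≡ vert y → vert (R₀ x) ≡ vert (R₀ y) → SameEdge M x y
    edge-inj x y same-vert same-vert₀ = same-edge (edge-stabiliser w fixes-0 fixes-1)
      where
      w : Aff
      w = elt x ⁻¹ ∙ elt y
      fixes-0 : act w origin ≡ origin
      fixes-0 = relative-fixes x y origin (ψ-injective same-vert)
      fixes-1 : act (w ∙ ρ₀) origin ≡ act ρ₀ origin
      fixes-1 = trans (act-∙ w ρ₀ origin) (relative-fixes x y (act ρ₀ origin)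
        (ψ-injective (trans (sym (vert-R ρ₀ x)) (trans same-vert₀ (vert-R ρ₀ y)))))
      same-edge : (w ≈ e) ⊎ (w ≈ ρ₂) → SameEdge M x y
      same-edge (inj₁ w≈e)  = subst (SameEdge M x) (sym y≡x) ε
        where
        y≡x : y ≡ x
        y≡x = trans (moved-by x y w≈e) (trans (cong [_] (∙-identityʳ (elt x))) ([]-elt x))
      same-edge (inj₂ w≈ρ₂) = return (inj₂ (trans (moved-by x y w≈ρ₂) (sym (elt≈⇒≡[] (elt-R ρ₂ x)))))

    φ : SkeletonIso M (V n m) (Adj n m)
    φ = record
      { vert = vert ; vert-surj = vert-surj ; vert-same = vert-same ; same-vert = same-vert
      ; edge-adj = edge-adj ; edge-surj = edge-surj ; edge-inj = edge-inj }

    vert-iter-RR : ∀ ρ ρ′ k x → vert (iter (R ρ′ ∘ R ρ) k x) ≡ ψ (act (elt x) (act ((ρ ∙ ρ′) ^ k) origin))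
    vert-iter-RR ρ ρ′ k x =
      cong ψ (trans (act-cong (elt-iter-RR ρ ρ′ k x) origin) (act-∙ (elt x) ((ρ ∙ ρ′) ^ k) origin))

    face-fibre-injective : ∀ o o′ → face-fibre o ≋⟨ m ⟩ face-fibre o′ → o ≡ o′
    face-fibre-injective false false _ = refl
    face-fibre-injective false true  p = ⊥-elim (0≋̸-1 p)
    face-fibre-injective true  false p = ⊥-elim (0≋̸-1 (≋-sym p))
    face-fibre-injective true  true  _ = refl

    face-vertices-distinct : ∀ x i j → i < j → j < 2 * n →
                             vert (iter (faceRot M) i x) ≢ vert (iter (faceRot M) j x)
    face-vertices-distinct x i j i<j j<2n eq = ℕₚ.<⇒≢ i<j
      (≋-same-parity⇒≡ n′ n-odd (ℕₚ.<-trans i<j j<2n) j<2n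
        (face-fibre-injective _ _ (proj₂ positions))
        (≋-trans (≋-reflexive (sym (ℤₚ.neg-involutive (+ i))))
                 (≋-trans (≋-neg (proj₁ positions)) (≋-reflexive (ℤₚ.neg-involutive (+ j))))))
      where
      same-position : act ((ρ₀ ∙ ρ₁) ^ i) origin ≡ act ((ρ₀ ∙ ρ₁) ^ j) origin
      same-position = act-injective (elt x)
        (ψ-injective (trans (sym (vert-iter-RR ρ₀ ρ₁ i x)) (trans eq (vert-iter-RR ρ₀ ρ₁ j x))))
      rotated : ℕ → Aff
      rotated k = mk false (- + k) (odd k) (face-fibre (odd k)) (+ 0)
      positions : (- + i ≋⟨ n ⟩ - + j) × (face-fibre (odd i) ≋⟨ m ⟩ face-fibre (odd j))
      positions = act-origin-injective (rotated i) (rotated j)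
        (subst₂ (λ g h → act g origin ≡ act h origin) (face-rotation-^ i) (face-rotation-^ j) same-position)

    face-invariant : Flag → Fin m
    face-invariant x = reduceₘ (sg (δ (elt x)) · b (elt x))

    face-invariant-≈ : ∀ {x g} → elt x ≈ g → face-invariant x ≡ reduceₘ (sg (δ g) · b g)
    face-invariant-≈ p = reduceₘ-cong (≋-· (≋-reflexive (cong sg (δ-eq p))) (b-eq p))

    face-invariant-R : ∀ u f a x → face-invariant (R (mk true u f a (+ 0)) x) ≡ face-invariant x
    face-invariant-R u f a x = trans (face-invariant-≈ (elt-R _ x)) (reduceₘ-cong (≋-reflexive
      (trans (cong (λ c → c · (sg (Aff.f g) · + 0 + b g · -1ℤ)) (sg-xor (δ g) true))
             (lemma (sg (δ g)) (sg (Aff.f g)) (b g)))))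
      where
      g : Aff
      g = elt x
      lemma : ∀ D F B → D · -1ℤ · (F · + 0 + B · -1ℤ) ≡ D · B
      lemma = solve-∀

    R₂-changes-face-invariant : ∀ x → face-invariant (R₂ x) ≢ face-invariant x
    R₂-changes-face-invariant x eq = sg·2≋̸0 (δ g xor f g) (≋-+-cancelˡ (sg (δ g) · b g) (begin
      sg (δ g) · b g + sg (δ g xor f g) · + 2                    ≡⟨ after-ρ₂ ⟩
      sg (δ g xor false) · (sg (f g) · + 2 + b g · + 1)          ≈⟨ changed ⟩
      sg (δ g) · b g                                             ≡⟨ ℤₚ.+-identityʳ _ ⟨
      sg (δ g) · b g + + 0                                       ∎))
      where
      open ≋-Reasoning
      g : Aff
      g = elt x
      lemma : ∀ D F B → D · B + D · F · + 2 ≡ D · (F · + 2 + B · + 1)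
      lemma = solve-∀
      after-ρ₂ : sg (δ g) · b g + sg (δ g xor f g) · + 2 ≡ sg (δ g xor false) · (sg (f g) · + 2 + b g · + 1)
      after-ρ₂ = trans (cong (λ c → sg (δ g) · b g + c · + 2) (sg-xor (δ g) (f g)))
        (trans (lemma (sg (δ g)) (sg (f g)) (b g))
               (cong (λ c → sg c · (sg (f g) · + 2 + b g · + 1)) (sym (Boolₚ.xor-identityʳ (δ g)))))
      changed : sg (δ g xor false) · (sg (f g) · + 2 + b g · + 1) ≋⟨ m ⟩ sg (δ g) · b g
      changed = reduceₘ-injective (trans (sym (face-invariant-≈ (elt-R ρ₂ x))) eq)

    R₂-leaves-face : ∀ x → ¬ SameFace M x (R₂ x)
    R₂-leaves-face x path =
      R₂-changes-face-invariant x (Star-respects (λ y → face-invariant y ≡ face-invariant x) step path refl)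
      where
      step : ∀ {y z} → (z ≡ R₀ y) ⊎ (z ≡ R₁ y) → face-invariant y ≡ face-invariant x →
             face-invariant z ≡ face-invariant x
      step (inj₁ refl) eq = trans (face-invariant-R -1ℤ true -1ℤ _) eq
      step (inj₂ refl) eq = trans (face-invariant-R (+ 0) false (+ 0) _) eq

    polytopal : Polytopal M φ
    polytopal = (λ x → 2 * n , proj₁ (hasType x) , 3≤2n , face-vertices-distinct x) , R₂-leaves-face
      where
      3≤2n : 3 ≤ 2 * n
      3≤2n = ℕₚ.≤-trans 3≤m (ℕₚ.≤-trans (ℕₚ.m≤n*m m s) (ℕₚ.m≤m+n n (n ℕ.+ 0)))

    aut-is-L : ∀ g → IsAut M g → ∀ x → g x ≡ L (elt (g x₀)) x
    aut-is-L g G = aut-unique M G (isAut-L (elt (g x₀))) (sym (trans (L-x₀ (elt (g x₀))) ([]-elt (g x₀))))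

    induced-∈ : ∀ γ → ⟨ σ₁ n m , σ₂ n m ⟩ (induced γ)
    induced-∈ = σ′-generate (record
      { ≈-closed  = λ g≈h d → ext d (induced-cong g≈h)
      ; σ₁′∈      = ext gen₁ (λ p → sym (induced-σ₁′ p))
      ; σ₂′∈      = ext gen₂ (λ p → sym (induced-σ₂′ p))
      ; ∙-closed  = λ {g} {h} dg dh → ext (mul dh dg) (λ p → sym (induced-∙ g h p))
      ; ⁻¹-closed = λ {g} dg → inv dg (induced-inverseˡ g) (induced-inverseʳ g)
      })

    aut-induces : ∀ g → IsAut M g → Σ (V n m → V n m) λ h → ⟨ σ₁ n m , σ₂ n m ⟩ h × Induces M φ g h
    aut-induces g G = induced γ , induced-∈ γ , λ x → trans (cong vert (aut-is-L g G x)) (vert-L γ x)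
      where
      γ : Aff
      γ = elt (g x₀)

    record σ′-Closed (P : (Flag → Flag) → Set) : Set where
      field
        L-σ₁′∈    : P (L σ₁′)
        L-σ₂′∈    : P (L σ₂′)
        id∈       : P id
        ∘-closed  : ∀ {g h} → P g → P h → P (h ∘ g)
        inverse-closed : ∀ {g g⁻} → P g → (∀ x → g⁻ (g x) ≡ x) → (∀ x → g (g⁻ x) ≡ x) → P g⁻
        automorphism : ∀ {g} → P g → IsAut M g

    lift : ∀ {P} → σ′-Closed P → ∀ {h} → ⟨ σ₁ n m , σ₂ n m ⟩ h → Σ (Flag → Flag) λ g → P g × Induces M φ g h
    lift C gen₁ = L σ₁′ , σ′-Closed.L-σ₁′∈ C , λ x → trans (vert-L σ₁′ x) (induced-σ₁′ (vert x))
    lift C gen₂ = L σ₂′ , σ′-Closed.L-σ₂′∈ C , λ x → trans (vert-L σ₂′ x) (induced-σ₂′ (vert x))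
    lift C one  = id , σ′-Closed.id∈ C , λ x → refl
    lift C (mul {k = k} dh dk) with lift C dh | lift C dk
    ... | g , Pg , g↦h | g′ , Pg′ , g′↦k =
      g′ ∘ g , σ′-Closed.∘-closed C Pg Pg′ , λ x → trans (g′↦k (g x)) (cong k (g↦h x))
    lift C (inv {h} {k} dh kh _) with lift C dh
    ... | g , Pg , g↦h with σ′-Closed.automorphism C Pg
    ...   | (g⁻ , left , right) , _ = g⁻ , σ′-Closed.inverse-closed C Pg left right , λ x → begin
      vert (g⁻ x)               ≡⟨ kh (vert (g⁻ x)) ⟨
      k (h (vert (g⁻ x)))       ≡⟨ cong k (g↦h (g⁻ x)) ⟨
      k (vert (g (g⁻ x)))       ≡⟨ cong (k ∘ vert) (right x) ⟩
      k (vert x)                ∎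
      where open ≡-Reasoning
    lift C (ext dh h≗k) with lift C dh
    ... | g , Pg , g↦h = g , Pg , λ x → trans (g↦h x) (h≗k (vert x))

    automorphisms-closed : σ′-Closed (IsAut M)
    automorphisms-closed = record
      { L-σ₁′∈ = isAut-L σ₁′ ; L-σ₂′∈ = isAut-L σ₂′ ; id∈ = isAut-id M
      ; ∘-closed = λ G H → isAut-∘ M H G ; inverse-closed = isAut-inverse M ; automorphism = id }

    rotations-closed : σ′-Closed ⟨ L σ₁′ , L σ₂′ ⟩
    rotations-closed = record
      { L-σ₁′∈ = gen₁ ; L-σ₂′∈ = gen₂ ; id∈ = one ; ∘-closed = mul ; inverse-closed = inv
      ; automorphism = ⟨⟩-isAut M (isAut-L σ₁′) (isAut-L σ₂′) }

    automorphisms-induce-G : InducedGroupIs M φ (IsAut M) ⟨ σ₁ n m , σ₂ n m ⟩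
    automorphisms-induce-G = aut-induces , λ h → lift automorphisms-closed

    rotations-induce-G : InducedGroupIs M φ ⟨ L σ₁′ , L σ₂′ ⟩ ⟨ σ₁ n m , σ₂ n m ⟩
    rotations-induce-G =
      (λ g d → aut-induces g (σ′-Closed.automorphism rotations-closed d)) , λ h → lift rotations-closed

proposition5p2 : (m s : ℕ) → Odd m → 3 ≤ m → Odd s → 1 ≤ s →
    Σ FlagMap λ M →
    Σ (SkeletonIso M (V (s * m) m) (Adj (s * m) m)) λ φ →
      Polytopal M φ × NonOrientable M × Reflexible M
      × HasType M (2 * (s * m)) (2 * m)
      × InducedGroupIs M φ (IsAut M) ⟨ σ₁ (s * m) m , σ₂ (s * m) m ⟩
      × (∃ λ a → ∃ λ g₁ → ∃ λ g₂ → Distinguished M a g₁ g₂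
           × InducedGroupIs M φ ⟨ g₁ , g₂ ⟩ ⟨ σ₁ (s * m) m , σ₂ (s * m) m ⟩)
-- The hypothesis 1 ≤ s already follows from Odd s.
proposition5p2 m s (mj , refl) 3≤m (sk , refl) _ =
  M , φ 3≤m , polytopal 3≤m , nonOrientable , reflexible , hasType , automorphisms-induce-G 3≤m ,
  x₀ , L σ₁′ , L σ₂′ , distinguished , rotations-induce-G 3≤m
  where open Construction mj sk
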